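{- Let $A\in\mathcal{A}_{n,1}$ and $(N,E)=\Lambda(A)$. Then $-\ell(N)\le B(A)\le c(N)$.
   Context: An alternating sign matrix (ASM) of order $n$ is an $n\times n$ matrix with entries in $\{1,0,-1\}$ such that in every row and every column the nonzero entries alternate in sign, beginning and ending with $1$. Rows are numbered top to bottom, columns left to right; "below" means larger row index. $\mathcal{A}_{n,1}$ is the set of order-$n$ ASMs with exactly one entry $-1$; $\overline{A}=(a_{u,n+1-v})$ is the vertical reflection of $A=(a_{uv})$. For $A\in\mathcal{A}_{n,1}$: opening column = column of the $-1$; opening row = row of the highest $1$ in the opening column; closing row = row of the $-1$. Left/right side: columns strictly left/right of the opening column. The closing row has exactly two $1$'s, one on each side; the right one is the closing $1$, its column the closing column. Enclosed rows: strictly between opening and closing rows. $A$ is neutral if there are none; otherwise positive (resp. negative) if the $1$ of the lowest enclosed row lies in the right (resp. left) side; sets $\mathcal{A}_{n,1}^{+},\mathcal{A}_{n,1}^{0},\mathcal{A}_{n,1}^{ - }$. For $A\in\mathcal{A}_{n,1}^{+}\cup\mathcal{A}_{n,1}^{0}$: charged cell = enclosed rows $\times$ right side; extended neutral cell = rows from opening to closing row inclusive $\times$ left side; leading $1$ = highest $1$ of the left side strictly below the opening row, leading column its column; leading cell = entries strictly below the opening row strictly between leading and opening columns, $\ell(A)$ its sum; closing cell = entries strictly below the closing row strictly between opening and closing columns, $c(A)$ its sum; extended closing cell = entries strictly below the closing row in columns from opening to closing column inclusive. $E(A)$ = sum of the charged cell if $A$ positive, $0$ if neutral, $-E(\overline{A})$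 if negative. $B(A)=c(A)-\ell(A)$ for $A\in\mathcal{A}_{n,1}^{+}\cup\mathcal{A}_{n,1}^{0}$, and $B(A)=-B(\overline{A})$ for $A$ negative. $H$, $V$: for an $m\times p$ $(0,1)$-matrix $Q$ with nonzero columns $j_1=1<\dots<j_t<p$, $H(Q)$ moves column $j_i$ to $j_{i+1}$ ($j_{t+1}=p$) and zeroes column 1; for $Q$ with zero first row and nonzero last row, nonzero rows $i_1<\dots<i_t=m$, $V(Q)$ moves row $i_s$ to $i_{s-1}$ ($i_0=1$) and zeroes row $m$. For $A\in\mathcal{A}_{n,1}^{+}\cup\mathcal{A}_{n,1}^{0}$, $\delta(A)$: (1) replace the $-1$ and the closing $1$ by $0$; (2) apply $H$ to the extended closing cell; (3) apply $V$ to the extended neutral cell; (4) move every $1$ of the extended neutral cell and the charged cell down one row in its column (vacated positions become $0$); cells refer to positions in $A$. $\Delta(A)=(k,\delta(A),c(A),E(A))$, $k$ the opening row index; $\Delta$ is injective and if $\Delta(A)=(k,P,c,E)$ there is a unique $N\in\mathcal{A}_{n,1}^{0}$ with $\Delta(N)=(k,P,c+E,0)$. $\Lambda$: for $A\in\mathcal{A}_{n,1}^{+}\cup\mathcal{A}_{n,1}^{0}$ with $\Delta(A)=(k,P,c,E)$, $\Lambda(A)=(N,E)$ where $N\in\mathcal{A}_{n,1}^{0}$ satisfies $\Delta(N)=(k,P,c+E,0)$; for $A$ negative, if $\Lambda(\overline{A})=(M,F)$ then $\Lambda(A)=(\overline{M},-F)$. -}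

module Defs where

open import Data.Bool using (Bool; true; false; if_then_else_; _∧_; _∨_; not)
open import Data.Nat as ℕ using (ℕ; zero; suc; _∸_; _<ᵇ_; _≡ᵇ_; _≤ᵇ_)
import Data.Nat.Properties as ℕP
open import Data.Integer as ℤ using (ℤ; 0ℤ; 1ℤ; -1ℤ)
open import Data.Fin using (Fin; toℕ; fromℕ<; opposite)
open import Data.List using (List; []; _∷_; map; foldr; foldl; upTo; filterᵇ)
open import Data.Maybe using (Maybe; just; nothing; fromMaybe)
open import Data.Product using (Σ; _×_; _,_)
open import Data.Sum using (_⊎_)
open import Relation.Nullary using (does; yes; no; ¬_)
open import Relation.Binary.PropositionalEquality using (_≡_)

-- Internally we use 0-based ℕ coordinates (row/col index k in the paper
-- is k-1 here); all comparisons are consistent so this is harmless.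

Matrix : ℕ → Set
Matrix n = Fin n → Fin n → ℤ

ent : ∀ {n} → Matrix n → ℕ → ℕ → ℤ
ent {n} A i j with i ℕ.<? n | j ℕ.<? n
... | yes p | yes q = A (fromℕ< p) (fromℕ< q)
... | _     | _     = 0ℤ

fromℕℕ : ∀ {n} → (ℕ → ℕ → ℤ) → Matrix n
fromℕℕ f i j = f (toℕ i) (toℕ j)

_==_ : ℤ → ℤ → Bool
x == y = does (x ℤ.≟ y)

range : ℕ → ℕ → List ℕ
range lo hi = map (lo ℕ.+_) (upTo (hi ∸ lo))

anyIn : ℕ → ℕ → (ℕ → Bool) → Bool
anyIn lo hi p = foldr (λ k b → p k ∨ b) false (range lo hi)

firstIn : ℕ → ℕ → (ℕ → Bool) → Maybe ℕ
firstIn lo hi p = foldr (λ k acc → if p k then just k else acc) nothing (range lo hi)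

lastIn : ℕ → ℕ → (ℕ → Bool) → Maybe ℕ
lastIn lo hi p = foldl (λ acc k → if p k then just k else acc) nothing (range lo hi)

leastIn : ℕ → ℕ → (ℕ → Bool) → ℕ
leastIn lo hi p = fromMaybe hi (firstIn lo hi p)

sumIn : ℕ → ℕ → (ℕ → ℤ) → ℤ
sumIn lo hi f = foldr (λ k s → f k ℤ.+ s) 0ℤ (range lo hi)

blockSum : ∀ {n} → Matrix n → ℕ → ℕ → ℕ → ℕ → ℤ
blockSum A r0 r1 c0 c1 = sumIn r0 r1 (λ i → sumIn c0 c1 (λ j → ent A i j))

data Alternating : List ℤ → Set where
  alt-one  : Alternating (1ℤ ∷ [])
  alt-step : ∀ {xs} → Alternating xs → Alternating (1ℤ ∷ -1ℤ ∷ xs)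

nonzeros : List ℤ → List ℤ
nonzeros = filterᵇ (λ x → not (x == 0ℤ))

rowList : ∀ {n} → Matrix n → Fin n → List ℤ
rowList {n} A i = map (λ j → ent A (toℕ i) j) (upTo n)

colList : ∀ {n} → Matrix n → Fin n → List ℤ
colList {n} A j = map (λ i → ent A i (toℕ j)) (upTo n)

record IsASM {n : ℕ} (A : Matrix n) : Set where
  field
    entries : ∀ i j → A i j ≡ 1ℤ ⊎ A i j ≡ 0ℤ ⊎ A i j ≡ -1ℤ
    rowsAlt : ∀ i → Alternating (nonzeros (rowList A i))
    colsAlt : ∀ j → Alternating (nonzeros (colList A j))

ExactlyOneMinus : ∀ {n} → Matrix n → Set
ExactlyOneMinus {n} A =
  Σ (Fin n × Fin n) λ { (r , c) →
    A r c ≡ -1ℤ × (∀ i j → A i j ≡ -1ℤ → (i ≡ r × j ≡ c)) }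

InA1 : ∀ {n} → Matrix n → Set
InA1 A = IsASM A × ExactlyOneMinus A

reflect : ∀ {n} → Matrix n → Matrix n
reflect A i j = A i (opposite j)

module _ {n : ℕ} (A : Matrix n) where

  closingRow : ℕ
  closingRow = leastIn 0 n (λ i → anyIn 0 n (λ j → ent A i j == -1ℤ))

  openingCol : ℕ
  openingCol = leastIn 0 n (λ j → ent A closingRow j == -1ℤ)

  openingRow : ℕ
  openingRow = leastIn 0 n (λ i → ent A i openingCol == 1ℤ)

  closingCol : ℕ
  closingCol = leastIn (suc openingCol) n (λ j → ent A closingRow j == 1ℤ)

  leadingRow : ℕ
  leadingRow = leastIn (suc openingRow) n
                 (λ i → anyIn 0 openingCol (λ j → ent A i j == 1ℤ))

  leadingCol : ℕ
  leadingCol = leastIn 0 openingCol (λ j → ent A leadingRow j == 1ℤ)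

data Sign : Set where
  positive neutral negative : Sign

-- classification into 𝒜⁺, 𝒜⁰, 𝒜⁻ (meaningful for A ∈ 𝒜_{n,1})
sign : ∀ {n} → Matrix n → Sign
sign {n} A =
  if closingRow A ≤ᵇ suc (openingRow A) then neutral      -- no enclosed rows
  else if anyIn (suc (openingCol A)) n
            (λ j → ent A (closingRow A ∸ 1) j == 1ℤ)      -- lowest enclosed row
       then positive else negative

ℓ : ∀ {n} → Matrix n → ℤ
ℓ {n} A = blockSum A (suc (openingRow A)) n (suc (leadingCol A)) (openingCol A)

c : ∀ {n} → Matrix n → ℤ
c {n} A = blockSum A (suc (closingRow A)) n (suc (openingCol A)) (closingCol A)

chargedSum : ∀ {n} → Matrix n → ℤ
chargedSum {n} A = blockSum A (suc (openingRow A)) (closingRow A) (suc (openingCol A)) n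

E₀ : ∀ {n} → Matrix n → ℤ
E₀ A with sign A
... | positive = chargedSum A
... | _        = 0ℤ

E : ∀ {n} → Matrix n → ℤ
E A with sign A
... | negative = ℤ.- E₀ (reflect A)
... | _        = E₀ A

B₀ : ∀ {n} → Matrix n → ℤ
B₀ A = c A ℤ.- ℓ A

B : ∀ {n} → Matrix n → ℤ
B A with sign A
... | negative = ℤ.- B₀ (reflect A)
... | _        = B₀ A

inBlock : ℕ → ℕ → ℕ → ℕ → ℕ → ℕ → Bool
inBlock r0 r1 c0 c1 i j = (r0 ≤ᵇ i) ∧ (i <ᵇ r1) ∧ (c0 ≤ᵇ j) ∧ (j <ᵇ c1)

-- H: column j_{i} moves to j_{i+1} (j_{t+1} = last column), first column zeroed
applyH : ℕ → ℕ → ℕ → ℕ → (ℕ → ℕ → ℤ) → (ℕ → ℕ → ℤ)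
applyH r0 r1 c0 c1 M i j =
  if inBlock r0 r1 c0 c1 i j
  then (if (j ≡ᵇ (c1 ∸ 1)) ∨ colNZ j
        then (go (lastIn c0 j colNZ))
        else 0ℤ)
  else M i j
  where
    colNZ : ℕ → Bool
    colNZ j' = anyIn r0 r1 (λ i' → not (M i' j' == 0ℤ))
    go : Maybe ℕ → ℤ
    go (just j') = M i j'
    go nothing   = 0ℤ

-- V: row i_s moves to i_{s-1} (i_0 = first row), last row zeroed
applyV : ℕ → ℕ → ℕ → ℕ → (ℕ → ℕ → ℤ) → (ℕ → ℕ → ℤ)
applyV r0 r1 c0 c1 M i j =
  if inBlock r0 r1 c0 c1 i j
  then (if (i ≡ᵇ r0) ∨ rowNZ i
        then (go (firstIn (suc i) r1 rowNZ))
        else 0ℤ)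
  else M i j
  where
    rowNZ : ℕ → Bool
    rowNZ i' = anyIn c0 c1 (λ j' → not (M i' j' == 0ℤ))
    go : Maybe ℕ → ℤ
    go (just i') = M i' j
    go nothing   = 0ℤ

module _ {n : ℕ} (A : Matrix n) where
  private
    oc = openingCol A
    orr = openingRow A
    cr = closingRow A
    cc = closingCol A

    step1 : ℕ → ℕ → ℤ
    step1 i j = if (i ≡ᵇ cr) ∧ ((j ≡ᵇ oc) ∨ (j ≡ᵇ cc)) then 0ℤ else ent A i j

    step2 : ℕ → ℕ → ℤ
    step2 = applyH (suc cr) n oc (suc cc) step1

    step3 : ℕ → ℕ → ℤ
    step3 = applyV orr (suc cr) 0 oc step2

    region : ℕ → ℕ → Bool
    region i j = inBlock orr (suc cr) 0 oc i j ∨ inBlock (suc orr) cr (suc oc) n i j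

    -- (4) move every 1 of the region down one row (vacated positions 0)
    step4 : ℕ → ℕ → ℤ
    step4 zero j = if region zero j ∧ (step3 zero j == 1ℤ) then 0ℤ else step3 zero j
    step4 (suc i) j =
      if region i j ∧ (step3 i j == 1ℤ) then 1ℤ
      else if region (suc i) j ∧ (step3 (suc i) j == 1ℤ) then 0ℤ
      else step3 (suc i) j

  δ : Matrix n
  δ = fromℕℕ step4

-- Λ as a relation:  Λrel A N F  means  Λ(A) = (N , F).
-- For A ∈ 𝒜⁺ ∪ 𝒜⁰: N is the (unique, by the paper) N ∈ 𝒜⁰ with
--   Δ(N) = (k , δ(A) , c(A) + E(A) , 0),  and F = E(A).

data Λrel {n : ℕ} : Matrix n → Matrix n → ℤ → Set where
  nonneg : ∀ {A N} →
           ¬ (sign A ≡ negative) →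
           InA1 N → sign N ≡ neutral →
           openingRow N ≡ openingRow A →
           (∀ i j → δ N i j ≡ δ A i j) →
           c N ≡ c A ℤ.+ E A →
           E N ≡ 0ℤ →
           Λrel A N (E A)
  neg    : ∀ {A M F} →
           sign A ≡ negative →
           Λrel (reflect A) M F →
           Λrel A (reflect M) (ℤ.- F)

-- For A not negative, N = Λ(A) is neutral with the same opening row k and the same δ.
-- The opening column is the first 1 of row k of δ, and the leading column can be read
-- off row k+1 of δ, which holds the leading row of A moved up by V. On the left side
-- each column of A sums to 1, δ agrees with A above row k and row k of A vanishes, so
-- the part of the column below row k is determined by δ as well. Hence ℓ(N) = ℓ(A).
-- Cells avoiding the opening column have nonnegative sums, so
-- -ℓ(N) = -ℓ(A) ≤ c(A) - ℓ(A) = B(A) ≤ c(A) + E(A) = c(N).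
-- For A negative, Ā is positive (the 1 of the lowest enclosed row moves to the right
-- side). With Λ(Ā) = (M, F) the bounds for Ā negate into those for A, because
-- reflecting the neutral M exchanges its leading and closing cells: ℓ(M̄) = c(M) and
-- c(M̄) = ℓ(M).

module Submission where

open import Defs
open import Data.Nat using (ℕ)
open import Data.Integer using (ℤ; _≤_; -_)
open import Data.Product using (_×_)

open import Algebra.Bundles using (AbelianGroup)
open import Data.Bool using (Bool; true; false; if_then_else_; _∧_; _∨_; not; T)
open import Data.Bool.Properties using (T-≡; T-∧; ∧-zeroʳ; ∨-zeroʳ)
open import Data.Empty using (⊥-elim)
open import Data.Fin using (toℕ; fromℕ<; opposite)
import Data.Fin.Properties as FinP
open import Data.Integer as ℤ using (0ℤ; 1ℤ; -1ℤ; +≤+; _+_; _-_)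
import Data.Integer.Properties as ℤP
open import Data.List using (List; []; _∷_; _++_; map; foldr; upTo; applyUpTo)
open import Data.List.Membership.Propositional using (_∈_)
open import Data.List.Membership.Propositional.Properties using (∈-map⁺; ∈-map⁻; ∈-upTo⁺; ∈-upTo⁻)
open import Data.List.Properties using (map-upTo; map-++; foldr-map; map-id; filter-++)
open import Data.List.Relation.Unary.Any using (here; there)
open import Data.Maybe using (Maybe; just; nothing; fromMaybe)
open import Data.Nat as ℕ using (zero; suc; _∸_; _≤ᵇ_; _≡ᵇ_; z≤n; s≤s)
import Data.Nat.Properties as ℕP
open import Data.Product using (Σ; _,_; proj₁; proj₂)
open import Data.Sum using (_⊎_; inj₁; inj₂)
open import Data.Unit using (tt)
open import Function using (_∘_)
open import Function.Bundles using (Equivalence)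
open import Relation.Binary using (tri<; tri≈; tri>)
open import Relation.Binary.PropositionalEquality
open import Relation.Nullary using (¬_; yes; no)
open import Relation.Nullary.Decidable using (dec-true; dec-false)

open import Algebra.Properties.CommutativeSemigroup ℤP.+-commutativeSemigroup using (interchange)
open import Algebra.Properties.Group (AbelianGroup.group ℤP.+-0-abelianGroup) using (∙-cancelˡ)


true≢false : ¬ true ≡ false
true≢false ()

1≢0 : ¬ 1ℤ ≡ 0ℤ
1≢0 ()

if-false : ∀ {A : Set} {b} {x y : A} → b ≡ false → (if b then x else y) ≡ y
if-false refl = refl

T⇒≡true : ∀ {b} → T b → b ≡ true
T⇒≡true = Equivalence.to T-≡

¬T⇒≡false : ∀ {b} → ¬ T b → b ≡ false
¬T⇒≡false {false} _   = refl
¬T⇒≡false {true}  ¬tt = ⊥-elim (¬tt tt)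

≢⇒≡ᵇfalse : ∀ {m n} → ¬ m ≡ n → (m ≡ᵇ n) ≡ false
≢⇒≡ᵇfalse {m} {n} m≢n = ¬T⇒≡false (m≢n ∘ ℕP.≡ᵇ⇒≡ m n)

==-sound : ∀ {x y} → (x == y) ≡ true → x ≡ y
==-sound {x} {y} eq with x ℤ.≟ y
... | yes x≡y = x≡y
... | no _    = ⊥-elim (true≢false (sym eq))

==-complete : ∀ {x y} → x ≡ y → (x == y) ≡ true
==-complete {x} {y} = dec-true (x ℤ.≟ y)

==-false : ∀ {x y} → ¬ x ≡ y → (x == y) ≡ false
==-false {x} {y} = dec-false (x ℤ.≟ y)

Bit : ℤ → Set
Bit x = x ≡ 0ℤ ⊎ x ≡ 1ℤ

Bit⇒nonneg : ∀ {x} → Bit x → 0ℤ ≤ x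
Bit⇒nonneg (inj₁ refl) = +≤+ z≤n
Bit⇒nonneg (inj₂ refl) = +≤+ z≤n

+-nonneg : ∀ {x y} → 0ℤ ≤ x → 0ℤ ≤ y → 0ℤ ≤ x + y
+-nonneg (+≤+ _) (+≤+ _) = +≤+ z≤n

+-nonneg-zero : ∀ {x y} → 0ℤ ≤ x → 0ℤ ≤ y → x + y ≡ 0ℤ → x ≡ 0ℤ × y ≡ 0ℤ
+-nonneg-zero (+≤+ {n = a} _) (+≤+ _) a+b≡0 =
  cong ℤ.+_ (ℕP.m+n≡0⇒m≡0 a (ℤP.+-injective a+b≡0)) , cong ℤ.+_ (ℕP.m+n≡0⇒n≡0 a (ℤP.+-injective a+b≡0))

bit-before-minus : ∀ {a} → Bit a → Bit (a + -1ℤ) → a ≡ 1ℤ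
bit-before-minus (inj₂ a≡1)  _        = a≡1
bit-before-minus (inj₁ refl) (inj₁ ())
bit-before-minus (inj₁ refl) (inj₂ ())

bit-before-one : ∀ {a} → Bit a → Bit (a + 1ℤ) → a ≡ 0ℤ
bit-before-one (inj₁ a≡0)  _        = a≡0
bit-before-one (inj₂ refl) (inj₁ ())
bit-before-one (inj₂ refl) (inj₂ ())

bit-after-one : ∀ {t} → 0ℤ ≤ t → Bit (1ℤ + t) → t ≡ 0ℤ
bit-after-one (+≤+ {n = zero} _)  _        = refl
bit-after-one (+≤+ {n = suc _} _) (inj₁ ())
bit-after-one (+≤+ {n = suc _} _) (inj₂ ())

bit-complement : ∀ {a b} → a + b ≡ 1ℤ → Bit a → Bit b
bit-complement {b = b} a+b≡1 (inj₁ refl) = inj₂ (trans (sym (ℤP.+-identityˡ b)) a+b≡1)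
bit-complement {b = b} 1+b≡1 (inj₂ refl) = inj₁ (∙-cancelˡ 1ℤ b 0ℤ 1+b≡1)

bit-≠1⇒0 : ∀ {x} → Bit x → (x == 1ℤ) ≡ false → x ≡ 0ℤ
bit-≠1⇒0 (inj₁ x≡0) _  = x≡0
bit-≠1⇒0 (inj₂ refl) ()

bit-kill : ∀ {x} → Bit x → (if x == 1ℤ then 0ℤ else x) ≡ 0ℤ
bit-kill (inj₁ refl) = refl
bit-kill (inj₂ refl) = refl

bit-indicator : ∀ {x} → Bit x → ((if x == 1ℤ then 1ℤ else 0ℤ) == 1ℤ) ≡ (x == 1ℤ)
bit-indicator (inj₁ refl) = refl
bit-indicator (inj₂ refl) = refl

bit-nonzero : ∀ {x} → Bit x → not (x == 0ℤ) ≡ (x == 1ℤ)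
bit-nonzero (inj₁ refl) = refl
bit-nonzero (inj₂ refl) = refl


interval : ℕ → ℕ → List ℕ
interval lo zero    = []
interval lo (suc d) = lo ∷ interval (suc lo) d

applyUpTo-interval : ∀ d lo (f : ℕ → ℕ) → (∀ x → f x ≡ lo ℕ.+ x) → applyUpTo f d ≡ interval lo d
applyUpTo-interval zero    lo f f≗ = refl
applyUpTo-interval (suc d) lo f f≗ =
  cong₂ _∷_ (trans (f≗ 0) (ℕP.+-identityʳ lo))
            (applyUpTo-interval d (suc lo) (f ∘ suc) (λ x → trans (f≗ (suc x)) (ℕP.+-suc lo x)))

range-interval : ∀ lo hi → range lo hi ≡ interval lo (hi ∸ lo)
range-interval lo hi =
  trans (map-upTo (lo ℕ.+_) (hi ∸ lo)) (applyUpTo-interval (hi ∸ lo) lo (lo ℕ.+_) (λ _ → refl))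

interval-++ : ∀ a b lo → interval lo (a ℕ.+ b) ≡ interval lo a ++ interval (lo ℕ.+ a) b
interval-++ zero    b lo = cong (λ x → interval x b) (sym (ℕP.+-identityʳ lo))
interval-++ (suc a) b lo =
  cong (lo ∷_) (trans (interval-++ a b (suc lo)) (cong (λ x → interval (suc lo) a ++ interval x b) (sym (ℕP.+-suc lo a))))

range-++ : ∀ {lo m hi} → lo ℕ.≤ m → m ℕ.≤ hi → range lo hi ≡ range lo m ++ range m hi
range-++ {lo} {m} {hi} lo≤m m≤hi = begin
  range lo hi                                                 ≡⟨ range-interval lo hi ⟩
  interval lo (hi ∸ lo)                                       ≡⟨ cong (interval lo) distance ⟩
  interval lo ((m ∸ lo) ℕ.+ (hi ∸ m))                         ≡⟨ interval-++ (m ∸ lo) (hi ∸ m) lo ⟩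
  interval lo (m ∸ lo) ++ interval (lo ℕ.+ (m ∸ lo)) (hi ∸ m) ≡⟨ cong (λ x → interval lo (m ∸ lo) ++ interval x (hi ∸ m)) (ℕP.m+[n∸m]≡n lo≤m) ⟩
  interval lo (m ∸ lo) ++ interval m (hi ∸ m)                 ≡⟨ sym (cong₂ _++_ (range-interval lo m) (range-interval m hi)) ⟩
  range lo m ++ range m hi                                    ∎
  where
  open ≡-Reasoning
  distance : hi ∸ lo ≡ (m ∸ lo) ℕ.+ (hi ∸ m)
  distance = begin
    hi ∸ lo                   ≡⟨ cong (_∸ lo) (sym (ℕP.m∸n+n≡m m≤hi)) ⟩
    (hi ∸ m) ℕ.+ m ∸ lo       ≡⟨ ℕP.+-∸-assoc (hi ∸ m) lo≤m ⟩
    (hi ∸ m) ℕ.+ (m ∸ lo)     ≡⟨ ℕP.+-comm (hi ∸ m) (m ∸ lo) ⟩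
    (m ∸ lo) ℕ.+ (hi ∸ m)     ∎

range-singleton : ∀ m → range m (suc m) ≡ m ∷ []
range-singleton m = trans (range-interval m (suc m)) (cong (interval m) (ℕP.m+n∸n≡m 1 m))

range-empty : ∀ {lo hi} → hi ℕ.≤ lo → range lo hi ≡ []
range-empty {lo} {hi} hi≤lo = trans (range-interval lo hi) (cong (interval lo) (ℕP.m≤n⇒m∸n≡0 hi≤lo))

∈-range⁻ : ∀ {lo hi i} → i ∈ range lo hi → lo ℕ.≤ i × i ℕ.< hi
∈-range⁻ {lo} {hi} i∈ with ∈-map⁻ (lo ℕ.+_) i∈
... | x , x∈ , refl = ℕP.m≤m+n lo x , subst (lo ℕ.+ x ℕ.<_) (ℕP.m+[n∸m]≡n lo≤hi) (ℕP.+-monoʳ-< lo x<)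
  where
  x< : x ℕ.< hi ∸ lo
  x< = ∈-upTo⁻ x∈
  lo≤hi : lo ℕ.≤ hi
  lo≤hi = ℕP.<⇒≤ (ℕP.m∸n≢0⇒n<m (ℕP.m<n⇒n≢0 x<))

∈-range⁺ : ∀ {lo hi i} → lo ℕ.≤ i → i ℕ.< hi → i ∈ range lo hi
∈-range⁺ {lo} {hi} {i} lo≤i i<hi =
  subst (_∈ range lo hi) (ℕP.m+[n∸m]≡n lo≤i) (∈-map⁺ (lo ℕ.+_) (∈-upTo⁺ (ℕP.∸-monoˡ-< i<hi lo≤i)))

onRange : ∀ {lo hi} {P : ℕ → Set} → (∀ i → lo ℕ.≤ i → i ℕ.< hi → P i) → ∀ {i} → i ∈ range lo hi → P i
onRange h i∈ with ∈-range⁻ i∈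
... | lo≤i , i<hi = h _ lo≤i i<hi

foldr-cong-∈ : ∀ {A B : Set} {f g : A → B → B} (e : B) {xs : List A} →
  (∀ {x} → x ∈ xs → ∀ b → f x b ≡ g x b) → foldr f e xs ≡ foldr g e xs
foldr-cong-∈ e {[]}     f≗g = refl
foldr-cong-∈ {g = g} e {x ∷ xs} f≗g = trans (f≗g (here refl) _) (cong (g x) (foldr-cong-∈ e (f≗g ∘ there)))

module _ (lo hi : ℕ) where

  anyIn-cong : ∀ {p q : ℕ → Bool} → (∀ i → lo ℕ.≤ i → i ℕ.< hi → p i ≡ q i) → anyIn lo hi p ≡ anyIn lo hi q
  anyIn-cong p≗q = foldr-cong-∈ false (λ i∈ b → cong (_∨ b) (onRange p≗q i∈))

  firstIn-cong : ∀ {p q : ℕ → Bool} → (∀ i → lo ℕ.≤ i → i ℕ.< hi → p i ≡ q i) → firstIn lo hi p ≡ firstIn lo hi q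
  firstIn-cong p≗q = foldr-cong-∈ nothing (λ {i} i∈ b → cong (λ z → if z then just i else b) (onRange p≗q i∈))

  leastIn-cong : ∀ {p q : ℕ → Bool} → (∀ i → lo ℕ.≤ i → i ℕ.< hi → p i ≡ q i) → leastIn lo hi p ≡ leastIn lo hi q
  leastIn-cong p≗q = cong (fromMaybe hi) (firstIn-cong p≗q)

  sumIn-cong : ∀ {f g : ℕ → ℤ} → (∀ i → lo ℕ.≤ i → i ℕ.< hi → f i ≡ g i) → sumIn lo hi f ≡ sumIn lo hi g
  sumIn-cong f≗g = foldr-cong-∈ 0ℤ (λ i∈ b → cong (_+ b) (onRange f≗g i∈))

  anyIn-true : ∀ (p : ℕ → Bool) {w} → lo ℕ.≤ w → w ℕ.< hi → p w ≡ true → anyIn lo hi p ≡ true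
  anyIn-true p {w} lo≤w w<hi pw = go (∈-range⁺ lo≤w w<hi)
    where
    go : ∀ {xs} → w ∈ xs → foldr (λ k b → p k ∨ b) false xs ≡ true
    go (here refl) rewrite pw = refl
    go {x ∷ _} (there w∈) rewrite go w∈ = ∨-zeroʳ (p x)

  anyIn-false : ∀ (p : ℕ → Bool) {w} → anyIn lo hi p ≡ false → lo ℕ.≤ w → w ℕ.< hi → p w ≡ false
  anyIn-false p {w} none lo≤w w<hi with p w in pw
  ... | false = refl
  ... | true  = trans (sym (anyIn-true p lo≤w w<hi pw)) none

  anyIn-none : ∀ (p : ℕ → Bool) → (∀ i → lo ℕ.≤ i → i ℕ.< hi → p i ≡ false) → anyIn lo hi p ≡ false
  anyIn-none p none = trans (anyIn-cong none) (go (range lo hi))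
    where
    go : ∀ xs → foldr (λ k b → false ∨ b) false xs ≡ false
    go []       = refl
    go (_ ∷ xs) = go xs

record IsLeastIn (lo hi : ℕ) (p : ℕ → Bool) (m : ℕ) : Set where
  field
    lower   : lo ℕ.≤ m
    upper   : m ℕ.< hi
    holds   : p m ≡ true
    minimal : ∀ i → lo ℕ.≤ i → i ℕ.< m → p i ≡ false

module _ {lo hi : ℕ} {p : ℕ → Bool} where

  private
    first : List ℕ → Maybe ℕ
    first = foldr (λ k acc → if p k then just k else acc) nothing

    first-just : ∀ {m} xs → first xs ≡ just m → m ∈ xs × p m ≡ true
    first-just (x ∷ xs) found with p x in px
    first-just (x ∷ xs) refl | true = here refl , px
    first-just (x ∷ xs) found | false with first-just xs found
    ... | m∈ , pm = there m∈ , pm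

    first-nothing : ∀ {i} xs → first xs ≡ nothing → i ∈ xs → p i ≡ false
    first-nothing (x ∷ xs) none i∈ with p x in px
    first-nothing (x ∷ xs) ()   i∈          | true
    first-nothing (x ∷ xs) none (here refl) | false = px
    first-nothing (x ∷ xs) none (there i∈)  | false = first-nothing xs none i∈

    first-minimal : ∀ {m} d from → first (interval from d) ≡ just m → ∀ i → from ℕ.≤ i → i ℕ.< m → p i ≡ false
    first-minimal (suc d) from found i from≤i i<m with p from in pfrom
    first-minimal (suc d) from refl  i from≤i i<m | true = ⊥-elim (ℕP.<-irrefl refl (ℕP.<-≤-trans i<m from≤i))
    ... | false with ℕP.m≤n⇒m<n∨m≡n from≤i
    ...   | inj₂ refl   = pfrom
    ...   | inj₁ from<i = first-minimal d (suc from) found i from<i i<m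

  firstIn-just : ∀ {m} → firstIn lo hi p ≡ just m → IsLeastIn lo hi p m
  firstIn-just {m} found with first-just (range lo hi) found
  ... | m∈ , pm = record
    { lower   = proj₁ (∈-range⁻ m∈)
    ; upper   = proj₂ (∈-range⁻ m∈)
    ; holds   = pm
    ; minimal = first-minimal (hi ∸ lo) lo (trans (cong first (sym (range-interval lo hi))) found)
    }

  firstIn-nothing : firstIn lo hi p ≡ nothing → ∀ i → lo ℕ.≤ i → i ℕ.< hi → p i ≡ false
  firstIn-nothing none i lo≤i i<hi = first-nothing (range lo hi) none (∈-range⁺ lo≤i i<hi)

  least-unique : ∀ {m m′} → IsLeastIn lo hi p m → IsLeastIn lo hi p m′ → m ≡ m′
  least-unique {m} {m′} L L′ with ℕP.<-cmp m m′
  ... | tri< m<m′ _ _ = ⊥-elim (true≢false (trans (sym (IsLeastIn.holds L)) (IsLeastIn.minimal L′ m (IsLeastIn.lower L) m<m′)))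
  ... | tri≈ _ m≡m′ _ = m≡m′
  ... | tri> _ _ m′<m = ⊥-elim (true≢false (trans (sym (IsLeastIn.holds L′)) (IsLeastIn.minimal L m′ (IsLeastIn.lower L′) m′<m)))

  least≤witness : ∀ {m w} → IsLeastIn lo hi p m → lo ℕ.≤ w → p w ≡ true → m ℕ.≤ w
  least≤witness {m} {w} L lo≤w pw with ℕP.<-≤-connex w m
  ... | inj₁ w<m = ⊥-elim (true≢false (trans (sym pw) (IsLeastIn.minimal L w lo≤w w<m)))
  ... | inj₂ m≤w = m≤w

  firstIn-least : ∀ {m} → IsLeastIn lo hi p m → firstIn lo hi p ≡ just m
  firstIn-least {m} L with firstIn lo hi p in found
  ... | just m′ = cong just (least-unique (firstIn-just found) L)
  ... | nothing = ⊥-elim (true≢false (trans (sym (IsLeastIn.holds L)) (firstIn-nothing found m (IsLeastIn.lower L) (IsLeastIn.upper L))))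

  leastIn-least : ∀ {m} → IsLeastIn lo hi p m → leastIn lo hi p ≡ m
  leastIn-least L = cong (fromMaybe hi) (firstIn-least L)

  leastIn-isLeast : ∀ {w} → lo ℕ.≤ w → w ℕ.< hi → p w ≡ true → IsLeastIn lo hi p (leastIn lo hi p)
  leastIn-isLeast {w} lo≤w w<hi pw with firstIn lo hi p in found
  ... | just m  = firstIn-just found
  ... | nothing = ⊥-elim (true≢false (trans (sym pw) (firstIn-nothing found w lo≤w w<hi)))

private
  sumOf : (ℕ → ℤ) → List ℕ → ℤ
  sumOf f = foldr (λ k s → f k + s) 0ℤ

  sumOf-++ : ∀ f xs ys → sumOf f (xs ++ ys) ≡ sumOf f xs + sumOf f ys
  sumOf-++ f []       ys = sym (ℤP.+-identityˡ _)
  sumOf-++ f (x ∷ xs) ys = trans (cong (_+_ (f x)) (sumOf-++ f xs ys)) (sym (ℤP.+-assoc (f x) _ _))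

  sumOf-zero : ∀ xs → sumOf (λ _ → 0ℤ) xs ≡ 0ℤ
  sumOf-zero []       = refl
  sumOf-zero (_ ∷ xs) = trans (ℤP.+-identityˡ _) (sumOf-zero xs)

  sumOf-+ : ∀ f g xs → sumOf (λ i → f i + g i) xs ≡ sumOf f xs + sumOf g xs
  sumOf-+ f g []       = refl
  sumOf-+ f g (x ∷ xs) = trans (cong (_+_ (f x + g x)) (sumOf-+ f g xs)) (interchange (f x) (g x) (sumOf f xs) (sumOf g xs))

  sumOf-swap : ∀ (f : ℕ → ℕ → ℤ) xs ys → sumOf (λ i → sumOf (f i) ys) xs ≡ sumOf (λ j → sumOf (λ i → f i j) xs) ys
  sumOf-swap f []       ys = sym (sumOf-zero ys)
  sumOf-swap f (x ∷ xs) ys =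
    trans (cong (_+_ (sumOf (f x) ys)) (sumOf-swap f xs ys)) (sym (sumOf-+ (f x) (λ j → sumOf (λ i → f i j) xs) ys))

  sumOf-nonneg : ∀ f xs → (∀ {i} → i ∈ xs → 0ℤ ≤ f i) → 0ℤ ≤ sumOf f xs
  sumOf-nonneg f []       _   = +≤+ z≤n
  sumOf-nonneg f (x ∷ xs) f≥0 = +-nonneg (f≥0 (here refl)) (sumOf-nonneg f xs (f≥0 ∘ there))

  sumOf-nonneg-zero : ∀ f xs → (∀ {i} → i ∈ xs → 0ℤ ≤ f i) → sumOf f xs ≡ 0ℤ → ∀ {i} → i ∈ xs → f i ≡ 0ℤ
  sumOf-nonneg-zero f (x ∷ xs) f≥0 sum≡0 i∈
    with +-nonneg-zero (f≥0 (here refl)) (sumOf-nonneg f xs (f≥0 ∘ there)) sum≡0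
  sumOf-nonneg-zero f (x ∷ xs) f≥0 sum≡0 (here refl) | fx≡0 , _    = fx≡0
  sumOf-nonneg-zero f (x ∷ xs) f≥0 sum≡0 (there i∈)  | _ , rest≡0 = sumOf-nonneg-zero f xs (f≥0 ∘ there) rest≡0 i∈

  sumOf-bits-nonzero : ∀ f xs → (∀ {i} → i ∈ xs → Bit (f i)) → ¬ sumOf f xs ≡ 0ℤ → Σ ℕ λ i → i ∈ xs × f i ≡ 1ℤ
  sumOf-bits-nonzero f []       bits sum≢0 = ⊥-elim (sum≢0 refl)
  sumOf-bits-nonzero f (x ∷ xs) bits sum≢0 with bits (here refl)
  ... | inj₂ fx≡1 = x , here refl , fx≡1
  ... | inj₁ fx≡0 with sumOf-bits-nonzero f xs (bits ∘ there) (sum≢0 ∘ trans (trans (cong (_+ sumOf f xs) fx≡0) (ℤP.+-identityˡ _)))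
  ...   | i , i∈ , fi≡1 = i , there i∈ , fi≡1

sumIn-split : ∀ lo m hi f → lo ℕ.≤ m → m ℕ.≤ hi → sumIn lo hi f ≡ sumIn lo m f + sumIn m hi f
sumIn-split lo m hi f lo≤m m≤hi = trans (cong (sumOf f) (range-++ lo≤m m≤hi)) (sumOf-++ f (range lo m) (range m hi))

module _ (lo hi : ℕ) (f : ℕ → ℤ) where

  sumIn-empty : hi ℕ.≤ lo → sumIn lo hi f ≡ 0ℤ
  sumIn-empty hi≤lo = cong (sumOf f) (range-empty hi≤lo)

  sumIn-zero : (∀ i → lo ℕ.≤ i → i ℕ.< hi → f i ≡ 0ℤ) → sumIn lo hi f ≡ 0ℤ
  sumIn-zero f≡0 = trans (sumIn-cong lo hi f≡0) (sumOf-zero (range lo hi))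

  sumIn-nonneg : (∀ i → lo ℕ.≤ i → i ℕ.< hi → 0ℤ ≤ f i) → 0ℤ ≤ sumIn lo hi f
  sumIn-nonneg f≥0 = sumOf-nonneg f (range lo hi) (onRange f≥0)

  sumIn-nonneg-zero : (∀ i → lo ℕ.≤ i → i ℕ.< hi → 0ℤ ≤ f i) → sumIn lo hi f ≡ 0ℤ →
                      ∀ i → lo ℕ.≤ i → i ℕ.< hi → f i ≡ 0ℤ
  sumIn-nonneg-zero f≥0 sum≡0 i lo≤i i<hi = sumOf-nonneg-zero f (range lo hi) (onRange f≥0) sum≡0 (∈-range⁺ lo≤i i<hi)

  sumIn-bits-nonzero : (∀ i → lo ℕ.≤ i → i ℕ.< hi → Bit (f i)) → ¬ sumIn lo hi f ≡ 0ℤ →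
                       Σ ℕ λ i → lo ℕ.≤ i × i ℕ.< hi × f i ≡ 1ℤ
  sumIn-bits-nonzero bits sum≢0 with sumOf-bits-nonzero f (range lo hi) (onRange bits) sum≢0
  ... | i , i∈ , fi≡1 = i , proj₁ (∈-range⁻ i∈) , proj₂ (∈-range⁻ i∈) , fi≡1

sumIn-singleton : ∀ m f → sumIn m (suc m) f ≡ f m
sumIn-singleton m f = trans (cong (sumOf f) (range-singleton m)) (ℤP.+-identityʳ (f m))

sumIn-snoc : ∀ lo m f → lo ℕ.≤ m → sumIn lo (suc m) f ≡ sumIn lo m f + f m
sumIn-snoc lo m f lo≤m = trans (sumIn-split lo m (suc m) f lo≤m (ℕP.n≤1+n m)) (cong (_+_ (sumIn lo m f)) (sumIn-singleton m f))

sumIn-cons : ∀ lo hi f → lo ℕ.< hi → sumIn lo hi f ≡ f lo + sumIn (suc lo) hi f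
sumIn-cons lo hi f lo<hi = trans (sumIn-split lo (suc lo) hi f (ℕP.n≤1+n lo) lo<hi) (cong (_+ sumIn (suc lo) hi f) (sumIn-singleton lo f))

sumIn-swap : ∀ a b c d (f : ℕ → ℕ → ℤ) →
  sumIn a b (λ i → sumIn c d (f i)) ≡ sumIn c d (λ j → sumIn a b (λ i → f i j))
sumIn-swap a b c d f = sumOf-swap f (range a b) (range c d)

sumIn-mirror : ∀ n {a b} f → a ℕ.≤ b → b ℕ.≤ n → sumIn a b (λ j → f (n ∸ suc j)) ≡ sumIn (n ∸ b) (n ∸ a) f
sumIn-mirror n {a} {b} f a≤b b≤n with ℕP.m≤n⇒m<n∨m≡n a≤b
... | inj₂ refl = trans (sumIn-empty a a (λ j → f (n ∸ suc j)) ℕP.≤-refl) (sym (sumIn-empty (n ∸ a) (n ∸ a) f ℕP.≤-refl))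
sumIn-mirror n {a} {suc b} f a≤1+b 1+b≤n | inj₁ (s≤s a≤b) = begin
  sumIn a (suc b) g                               ≡⟨ sumIn-snoc a b g a≤b ⟩
  sumIn a b g + f (n ∸ suc b)                     ≡⟨ cong (_+ f (n ∸ suc b)) (sumIn-mirror n f a≤b (ℕP.<⇒≤ 1+b≤n)) ⟩
  sumIn (n ∸ b) (n ∸ a) f + f (n ∸ suc b)         ≡⟨ ℤP.+-comm _ (f (n ∸ suc b)) ⟩
  f (n ∸ suc b) + sumIn (n ∸ b) (n ∸ a) f         ≡⟨ cong (λ x → f (n ∸ suc b) + sumIn x (n ∸ a) f) (ℕP.+-∸-assoc 1 1+b≤n) ⟩
  f (n ∸ suc b) + sumIn (suc (n ∸ suc b)) (n ∸ a) f ≡⟨ sumIn-cons (n ∸ suc b) (n ∸ a) f (ℕP.∸-monoʳ-< (s≤s a≤b) 1+b≤n) ⟨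
  sumIn (n ∸ suc b) (n ∸ a) f                     ∎
  where
  open ≡-Reasoning
  g : ℕ → ℤ
  g j = f (n ∸ suc j)


sumℤ : List ℤ → ℤ
sumℤ = foldr _+_ 0ℤ

1+[-1+x]≡x : ∀ x → 1ℤ + (-1ℤ + x) ≡ x
1+[-1+x]≡x x = trans (sym (ℤP.+-assoc 1ℤ -1ℤ x)) (ℤP.+-identityˡ x)

alternating-sum : ∀ {xs} → Alternating xs → sumℤ xs ≡ 1ℤ
alternating-sum alt-one      = refl
alternating-sum (alt-step a) = trans (1+[-1+x]≡x _) (alternating-sum a)

alternating-prefix : ∀ xs {ys} → Alternating (xs ++ ys) → Bit (sumℤ xs)
alternating-prefix []           _            = inj₁ refl
alternating-prefix (_ ∷ [])     alt-one      = inj₂ refl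
alternating-prefix (_ ∷ [])     (alt-step _) = inj₂ refl
alternating-prefix (_ ∷ _ ∷ xs) (alt-step a) = subst Bit (sym (1+[-1+x]≡x (sumℤ xs))) (alternating-prefix xs a)

sumℤ-nonzeros : ∀ xs → sumℤ (nonzeros xs) ≡ sumℤ xs
sumℤ-nonzeros []       = refl
sumℤ-nonzeros (x ∷ xs) with x ℤ.≟ 0ℤ
... | yes refl = trans (sumℤ-nonzeros xs) (sym (ℤP.+-identityˡ _))
... | no  _    = cong (_+_ x) (sumℤ-nonzeros xs)

record IsLine (n : ℕ) (f : ℕ → ℤ) : Set where
  field
    prefix : ∀ m → m ℕ.≤ n → Bit (sumIn 0 m f)
    total  : sumIn 0 n f ≡ 1ℤ

module _ {n : ℕ} {f : ℕ → ℤ} (L : IsLine n f) {p : ℕ} (p<n : p ℕ.< n) where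
  open IsLine L

  private
    prefix-step : Bit (sumIn 0 p f + f p)
    prefix-step = subst Bit (sumIn-snoc 0 p f z≤n) (prefix (suc p) p<n)

  IsLine-before-minus : f p ≡ -1ℤ → sumIn 0 p f ≡ 1ℤ
  IsLine-before-minus fp≡-1 = bit-before-minus (prefix p (ℕP.<⇒≤ p<n)) (subst (Bit ∘ _+_ (sumIn 0 p f)) fp≡-1 prefix-step)

  IsLine-before-one : f p ≡ 1ℤ → sumIn 0 p f ≡ 0ℤ
  IsLine-before-one fp≡1 = bit-before-one (prefix p (ℕP.<⇒≤ p<n)) (subst (Bit ∘ _+_ (sumIn 0 p f)) fp≡1 prefix-step)

  IsLine-after-minus : f p ≡ -1ℤ → sumIn (suc p) n f ≡ 1ℤ
  IsLine-after-minus fp≡-1 = begin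
    sumIn (suc p) n f                       ≡⟨ ℤP.+-identityˡ _ ⟨
    0ℤ + sumIn (suc p) n f                  ≡⟨ cong (λ x → x + sumIn (suc p) n f) up-to-p ⟨
    sumIn 0 (suc p) f + sumIn (suc p) n f   ≡⟨ sumIn-split 0 (suc p) n f z≤n p<n ⟨
    sumIn 0 n f                             ≡⟨ total ⟩
    1ℤ                                      ∎
    where
    open ≡-Reasoning
    up-to-p : sumIn 0 (suc p) f ≡ 0ℤ
    up-to-p = trans (sumIn-snoc 0 p f z≤n) (cong₂ _+_ (IsLine-before-minus fp≡-1) fp≡-1)

sumIn-as-sumℤ : ∀ lo hi f → sumIn lo hi f ≡ sumℤ (map f (range lo hi))
sumIn-as-sumℤ lo hi f = sym (foldr-map _+_ f 0ℤ (range lo hi))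

upTo-range : ∀ n → upTo n ≡ range 0 n
upTo-range n = sym (map-id (upTo n))

alternating⇒IsLine : ∀ n f → Alternating (nonzeros (map f (upTo n))) → IsLine n f
alternating⇒IsLine n f alt = record { prefix = prefix ; total = total }
  where
  open ≡-Reasoning
  line : List ℤ
  line = map f (upTo n)

  total : sumIn 0 n f ≡ 1ℤ
  total = begin
    sumIn 0 n f               ≡⟨ sumIn-as-sumℤ 0 n f ⟩
    sumℤ (map f (range 0 n))  ≡⟨ cong (sumℤ ∘ map f) (upTo-range n) ⟨
    sumℤ line                 ≡⟨ sumℤ-nonzeros line ⟨
    sumℤ (nonzeros line)      ≡⟨ alternating-sum alt ⟩
    1ℤ                        ∎

  prefix : ∀ m → m ℕ.≤ n → Bit (sumIn 0 m f)
  prefix m m≤n = subst Bit (trans (sumℤ-nonzeros before) (sym (sumIn-as-sumℤ 0 m f)))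
                   (alternating-prefix (nonzeros before) (subst Alternating split alt))
    where
    before after : List ℤ
    before = map f (range 0 m)
    after  = map f (range m n)
    split : nonzeros line ≡ nonzeros before ++ nonzeros after
    split = begin
      nonzeros line                              ≡⟨ cong (nonzeros ∘ map f) (trans (upTo-range n) (range-++ z≤n m≤n)) ⟩
      nonzeros (map f (range 0 m ++ range m n))  ≡⟨ cong nonzeros (map-++ f (range 0 m) (range m n)) ⟩
      nonzeros (before ++ after)                 ≡⟨ filter-++ _ before after ⟩
      nonzeros before ++ nonzeros after          ∎

IsLine-cong : ∀ {n f g} → (∀ j → j ℕ.< n → f j ≡ g j) → IsLine n f → IsLine n g
IsLine-cong {n} {f} {g} f≗g L = record
  { prefix = λ m m≤n → subst Bit (sumIn-cong 0 m (λ j _ j<m → f≗g j (ℕP.<-≤-trans j<m m≤n))) (prefix m m≤n)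
  ; total  = trans (sym (sumIn-cong 0 n (λ j _ → f≗g j))) total
  }
  where open IsLine L

IsLine-reverse : ∀ {n f} → IsLine n f → IsLine n (λ j → f (n ∸ suc j))
IsLine-reverse {n} {f} L = record
  { prefix = λ m m≤n → subst Bit (sym (sumIn-mirror n f z≤n m≤n))
                         (bit-complement (trans (sym (sumIn-split 0 (n ∸ m) n f z≤n (ℕP.m∸n≤m n m))) total) (prefix (n ∸ m) (ℕP.m∸n≤m n m)))
  ; total  = trans (sumIn-mirror n f z≤n ℕP.≤-refl) (trans (cong (λ lo → sumIn lo n f) (ℕP.n∸n≡0 n)) total)
  }
  where open IsLine L


module _ {n : ℕ} (X : Matrix n) where

  ent-inside : ∀ {i j} (i<n : i ℕ.< n) (j<n : j ℕ.< n) → ent X i j ≡ X (fromℕ< i<n) (fromℕ< j<n)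
  ent-inside {i} {j} i<n j<n with i ℕ.<? n | j ℕ.<? n
  ... | yes _   | yes _   = refl
  ... | no i≮n  | _       = ⊥-elim (i≮n i<n)
  ... | yes _   | no j≮n  = ⊥-elim (j≮n j<n)

  ent-outside-row : ∀ {i j} → n ℕ.≤ i → ent X i j ≡ 0ℤ
  ent-outside-row {i} {j} n≤i with i ℕ.<? n
  ... | yes i<n = ⊥-elim (ℕP.≤⇒≯ n≤i i<n)
  ... | no _    = refl

  ent-outside-col : ∀ {i j} → n ℕ.≤ j → ent X i j ≡ 0ℤ
  ent-outside-col {i} {j} n≤j with i ℕ.<? n | j ℕ.<? n
  ... | yes _ | yes j<n = ⊥-elim (ℕP.≤⇒≯ n≤j j<n)
  ... | yes _ | no _    = refl
  ... | no _  | _       = refl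

  ent-toℕ : ∀ i j → ent X (toℕ i) (toℕ j) ≡ X i j
  ent-toℕ i j = trans (ent-inside (FinP.toℕ<n i) (FinP.toℕ<n j))
                      (cong₂ X (FinP.fromℕ<-toℕ i _) (FinP.fromℕ<-toℕ j _))

  ent-view : ∀ i j → (Σ (i ℕ.< n) λ i<n → Σ (j ℕ.< n) λ j<n → ent X i j ≡ X (fromℕ< i<n) (fromℕ< j<n)) ⊎ ent X i j ≡ 0ℤ
  ent-view i j with i ℕ.<? n | j ℕ.<? n
  ... | yes i<n | yes j<n = inj₁ (i<n , j<n , refl)
  ... | yes _   | no _    = inj₂ refl
  ... | no _    | _       = inj₂ refl

ent-cong : ∀ {n} {X Y : Matrix n} → (∀ a b → X a b ≡ Y a b) → ∀ i j → ent X i j ≡ ent Y i j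
ent-cong {n} {X} {Y} X≗Y i j with ℕP.<-≤-connex i n | ℕP.<-≤-connex j n
... | inj₁ i<n | inj₁ j<n = trans (ent-inside X i<n j<n) (trans (X≗Y _ _) (sym (ent-inside Y i<n j<n)))
... | inj₂ n≤i | _        = trans (ent-outside-row X n≤i) (sym (ent-outside-row Y n≤i))
... | inj₁ _   | inj₂ n≤j = trans (ent-outside-col X n≤j) (sym (ent-outside-col Y n≤j))

record ASM₁ {n : ℕ} (X : Matrix n) : Set where
  field
    entry        : ∀ i j → ent X i j ≡ 1ℤ ⊎ ent X i j ≡ 0ℤ ⊎ ent X i j ≡ -1ℤ
    minusRow     : ℕ
    minusCol     : ℕ
    minusRow<n   : minusRow ℕ.< n
    minusCol<n   : minusCol ℕ.< n
    minus        : ent X minusRow minusCol ≡ -1ℤ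
    minus-unique : ∀ i j → ent X i j ≡ -1ℤ → i ≡ minusRow × j ≡ minusCol
    row          : ∀ i → i ℕ.< n → IsLine n (λ j → ent X i j)
    col          : ∀ j → j ℕ.< n → IsLine n (λ i → ent X i j)

0≢-1 : ¬ 0ℤ ≡ -1ℤ
0≢-1 ()

InA1⇒ASM₁ : ∀ {n} {X : Matrix n} → InA1 X → ASM₁ X
InA1⇒ASM₁ {n} {X} (asm , (r , c) , X[r,c]≡-1 , only-minus) = record
  { entry        = entry
  ; minusRow     = toℕ r
  ; minusCol     = toℕ c
  ; minusRow<n   = FinP.toℕ<n r
  ; minusCol<n   = FinP.toℕ<n c
  ; minus        = trans (ent-toℕ X r c) X[r,c]≡-1
  ; minus-unique = minus-unique
  ; row          = λ i i<n → alternating⇒IsLine n (ent X i)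
                     (subst (λ i′ → Alternating (nonzeros (map (ent X i′) (upTo n)))) (FinP.toℕ-fromℕ< i<n) (rowsAlt (fromℕ< i<n)))
  ; col          = λ j j<n → alternating⇒IsLine n (λ i → ent X i j)
                     (subst (λ j′ → Alternating (nonzeros (map (λ i → ent X i j′) (upTo n)))) (FinP.toℕ-fromℕ< j<n) (colsAlt (fromℕ< j<n)))
  }
  where
  open IsASM asm
  entry : ∀ i j → ent X i j ≡ 1ℤ ⊎ ent X i j ≡ 0ℤ ⊎ ent X i j ≡ -1ℤ
  entry i j with ent-view X i j
  ... | inj₁ (i<n , j<n , eq) rewrite eq = entries (fromℕ< i<n) (fromℕ< j<n)
  ... | inj₂ outside                     = inj₂ (inj₁ outside)
  minus-unique : ∀ i j → ent X i j ≡ -1ℤ → i ≡ toℕ r × j ≡ toℕ c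
  minus-unique i j eq with ent-view X i j
  ... | inj₂ outside = ⊥-elim (0≢-1 (trans (sym outside) eq))
  ... | inj₁ (i<n , j<n , inside) with only-minus (fromℕ< i<n) (fromℕ< j<n) (trans (sym inside) eq)
  ...   | i≡r , j≡c = trans (sym (FinP.toℕ-fromℕ< i<n)) (cong toℕ i≡r) , trans (sym (FinP.toℕ-fromℕ< j<n)) (cong toℕ j≡c)

opposite< : ∀ {n j} → j ℕ.< n → n ∸ suc j ℕ.< n
opposite< {suc n} {j} _ = s≤s (ℕP.m∸n≤m n j)

opposite-involutive : ∀ {n j} → j ℕ.< n → n ∸ suc (n ∸ suc j) ≡ j
opposite-involutive {suc n} (s≤s j≤n) = ℕP.m∸[m∸n]≡n j≤n

opposite-swap : ∀ {n j c} → j ℕ.< n ∸ suc c → c ℕ.< n ∸ suc j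
opposite-swap {n} {j} {c} j< =
  ℕP.m+n≤o⇒m≤o∸n (suc c) (subst (ℕ._≤ n) (ℕP.+-comm (suc j) (suc c)) (ℕP.m≤o∸n⇒m+n≤o (suc j) c<n j<))
  where
  c<n : suc c ℕ.≤ n
  c<n = ℕP.<⇒≤ (ℕP.m∸n≢0⇒n<m (ℕP.m<n⇒n≢0 j<))

Mirror : ∀ {n} → Matrix n → Matrix n → Set
Mirror {n} X Y = ∀ i j → j ℕ.< n → ent Y i j ≡ ent X i (n ∸ suc j)

reflect-mirror : ∀ {n} (X : Matrix n) → Mirror X (reflect X)
reflect-mirror {n} X i j j<n with ℕP.<-≤-connex i n
... | inj₂ n≤i = trans (ent-outside-row (reflect X) n≤i) (sym (ent-outside-row X n≤i))
... | inj₁ i<n = trans (ent-inside (reflect X) i<n j<n)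
                  (trans (cong (X (fromℕ< i<n)) opposite≡) (sym (ent-inside X i<n (opposite< j<n))))
  where
  opposite≡ : opposite (fromℕ< j<n) ≡ fromℕ< (opposite< j<n)
  opposite≡ = FinP.toℕ-injective (begin
    toℕ (opposite (fromℕ< j<n))   ≡⟨ FinP.opposite-prop (fromℕ< j<n) ⟩
    n ∸ suc (toℕ (fromℕ< j<n))    ≡⟨ cong (λ x → n ∸ suc x) (FinP.toℕ-fromℕ< j<n) ⟩
    n ∸ suc j                     ≡⟨ FinP.toℕ-fromℕ< (opposite< j<n) ⟨
    toℕ (fromℕ< (opposite< j<n))  ∎)
    where open ≡-Reasoning

mirror-sym : ∀ {n} {X Y : Matrix n} → Mirror X Y → Mirror Y X
mirror-sym {n} {X} {Y} X⇄Y i j j<n =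
  sym (trans (X⇄Y i (n ∸ suc j) (opposite< j<n)) (cong (ent X i) (opposite-involutive j<n)))

ASM₁-mirror : ∀ {n} {X Y : Matrix n} → ASM₁ X → Mirror X Y → ASM₁ Y
ASM₁-mirror {n} {X} {Y} G X⇄Y = record
  { entry        = entry′
  ; minusRow     = minusRow
  ; minusCol     = n ∸ suc minusCol
  ; minusRow<n   = minusRow<n
  ; minusCol<n   = opposite< minusCol<n
  ; minus        = trans (X⇄Y minusRow _ (opposite< minusCol<n)) (trans (cong (ent X minusRow) (opposite-involutive minusCol<n)) minus)
  ; minus-unique = minus-unique′
  ; row          = λ i i<n → IsLine-cong (λ j j<n → sym (X⇄Y i j j<n)) (IsLine-reverse (row i i<n))
  ; col          = λ j j<n → IsLine-cong (λ i _ → sym (X⇄Y i j j<n)) (col (n ∸ suc j) (opposite< j<n))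
  }
  where
  open ASM₁ G
  entry′ : ∀ i j → ent Y i j ≡ 1ℤ ⊎ ent Y i j ≡ 0ℤ ⊎ ent Y i j ≡ -1ℤ
  entry′ i j with ℕP.<-≤-connex j n
  ... | inj₁ j<n rewrite X⇄Y i j j<n = entry i (n ∸ suc j)
  ... | inj₂ n≤j = inj₂ (inj₁ (ent-outside-col Y n≤j))
  minus-unique′ : ∀ i j → ent Y i j ≡ -1ℤ → i ≡ minusRow × j ≡ n ∸ suc minusCol
  minus-unique′ i j eq with ℕP.<-≤-connex j n
  ... | inj₂ n≤j = ⊥-elim (0≢-1 (trans (sym (ent-outside-col Y n≤j)) eq))
  ... | inj₁ j<n with minus-unique i (n ∸ suc j) (trans (sym (X⇄Y i j j<n)) eq)
  ...   | i≡r , j′≡c = i≡r , trans (sym (opposite-involutive j<n)) (cong (λ x → n ∸ suc x) j′≡c)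


-- Opening and closing rows and columns

module Geometry {n : ℕ} {X : Matrix n} (G : ASM₁ X) where
  open ASM₁ G

  cr oc k : ℕ
  cr = closingRow X
  oc = openingCol X
  k  = openingRow X

  closingRow≡minusRow : cr ≡ minusRow
  closingRow≡minusRow = leastIn-least record
    { lower   = z≤n
    ; upper   = minusRow<n
    ; holds   = anyIn-true 0 n _ z≤n minusCol<n (==-complete minus)
    ; minimal = λ i _ i<mr → anyIn-none 0 n _ λ j _ _ → ==-false (λ eq → ℕP.<⇒≢ i<mr (proj₁ (minus-unique i j eq)))
    }

  openingCol≡minusCol : oc ≡ minusCol
  openingCol≡minusCol = trans (cong (λ r → leastIn 0 n (λ j → ent X r j == -1ℤ)) closingRow≡minusRow) (leastIn-least record
    { lower   = z≤n
    ; upper   = minusCol<n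
    ; holds   = ==-complete minus
    ; minimal = λ j _ j<mc → ==-false (λ eq → ℕP.<⇒≢ j<mc (proj₂ (minus-unique minusRow j eq)))
    })

  cr<n : cr ℕ.< n
  cr<n = subst (ℕ._< n) (sym closingRow≡minusRow) minusRow<n

  oc<n : oc ℕ.< n
  oc<n = subst (ℕ._< n) (sym openingCol≡minusCol) minusCol<n

  minus-at : ent X cr oc ≡ -1ℤ
  minus-at = subst₂ (λ i j → ent X i j ≡ -1ℤ) (sym closingRow≡minusRow) (sym openingCol≡minusCol) minus

  bit-unless-minus : ∀ i j → ¬ (i ≡ cr × j ≡ oc) → Bit (ent X i j)
  bit-unless-minus i j not-minus with entry i j
  ... | inj₁ is1          = inj₂ is1
  ... | inj₂ (inj₁ is0)   = inj₁ is0
  ... | inj₂ (inj₂ is-1) with minus-unique i j is-1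
  ...   | i≡mr , j≡mc = ⊥-elim (not-minus (trans i≡mr (sym closingRow≡minusRow) , trans j≡mc (sym openingCol≡minusCol)))

  bit-off-row : ∀ {i} j → ¬ i ≡ cr → Bit (ent X i j)
  bit-off-row {i} j i≢cr = bit-unless-minus i j (i≢cr ∘ proj₁)

  bit-off-col : ∀ i {j} → ¬ j ≡ oc → Bit (ent X i j)
  bit-off-col i {j} j≢oc = bit-unless-minus i j (j≢oc ∘ proj₂)

  blockSum-nonneg : ∀ r0 r1 c0 c1 → (∀ j → c0 ℕ.≤ j → j ℕ.< c1 → ¬ j ≡ oc) → 0ℤ ≤ blockSum X r0 r1 c0 c1
  blockSum-nonneg r0 r1 c0 c1 avoids-oc =
    sumIn-nonneg r0 r1 _ λ i _ _ → sumIn-nonneg c0 c1 _ λ j c0≤j j<c1 → Bit⇒nonneg (bit-off-col i (avoids-oc j c0≤j j<c1))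

  private
    minus-column = col oc oc<n
    closing-row  = row cr cr<n

  private
    one-above-minus : Σ ℕ λ w → 0 ℕ.≤ w × w ℕ.< cr × ent X w oc ≡ 1ℤ
    one-above-minus = sumIn-bits-nonzero 0 cr (λ i → ent X i oc) (λ i _ i<cr → bit-off-row oc (ℕP.<⇒≢ i<cr))
                        (1≢0 ∘ trans (sym (IsLine-before-minus minus-column cr<n minus-at)))

  opening : IsLeastIn 0 n (λ i → ent X i oc == 1ℤ) k
  opening = let (w , _ , w<cr , Xw≡1) = one-above-minus in
            leastIn-isLeast z≤n (ℕP.<-trans w<cr cr<n) (==-complete Xw≡1)

  k<cr : k ℕ.< cr
  k<cr = let (w , _ , w<cr , Xw≡1) = one-above-minus in
         ℕP.≤-<-trans (least≤witness opening z≤n (==-complete Xw≡1)) w<cr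

  k<n : k ℕ.< n
  k<n = ℕP.<-trans k<cr cr<n

  opening-one : ent X k oc ≡ 1ℤ
  opening-one = ==-sound (IsLeastIn.holds opening)

  above-opening : ∀ i → i ℕ.< k → ent X i oc ≡ 0ℤ
  above-opening i i<k =
    bit-≠1⇒0 (bit-off-row oc (ℕP.<⇒≢ (ℕP.<-trans i<k k<cr))) (IsLeastIn.minimal opening i z≤n i<k)

  enclosed-zero : ∀ i → k ℕ.< i → i ℕ.< cr → ent X i oc ≡ 0ℤ
  enclosed-zero i k<i i<cr = sumIn-nonneg-zero (suc k) (suc i) column entries≥0 below-k≡0 i k<i ℕP.≤-refl
    where
    column : ℕ → ℤ
    column i′ = ent X i′ oc
    entries≥0 : ∀ i′ → suc k ℕ.≤ i′ → i′ ℕ.< suc i → 0ℤ ≤ column i′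
    entries≥0 i′ _ i′≤i = Bit⇒nonneg (bit-off-row oc (ℕP.<⇒≢ (ℕP.<-≤-trans i′≤i i<cr)))
    through-k : sumIn 0 (suc k) column ≡ 1ℤ
    through-k = trans (sumIn-snoc 0 k column z≤n) (cong₂ _+_ (sumIn-zero 0 k column (λ i′ _ → above-opening i′)) opening-one)
    below-k≡0 : sumIn (suc k) (suc i) column ≡ 0ℤ
    below-k≡0 = bit-after-one (sumIn-nonneg (suc k) (suc i) column entries≥0)
      (subst Bit (trans (sumIn-split 0 (suc k) (suc i) column z≤n (ℕP.<⇒≤ (s≤s k<i))) (cong (λ x → x + sumIn (suc k) (suc i) column) through-k))
        (IsLine.prefix minus-column (suc i) (ℕP.<-trans i<cr cr<n)))

  opening-row-left : ∀ j → j ℕ.< oc → ent X k j ≡ 0ℤ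
  opening-row-left j j<oc = sumIn-nonneg-zero 0 oc (ent X k)
    (λ j′ _ j′<oc → Bit⇒nonneg (bit-off-col k (ℕP.<⇒≢ j′<oc)))
    (IsLine-before-one (row k k<n) oc<n opening-one) j z≤n j<oc

  closing-left-one : Σ ℕ λ j → j ℕ.< oc × ent X cr j ≡ 1ℤ
  closing-left-one =
    let (j , _ , j<oc , one) = sumIn-bits-nonzero 0 oc (ent X cr) (λ j _ j<oc → bit-off-col cr (ℕP.<⇒≢ j<oc))
                                 (1≢0 ∘ trans (sym (IsLine-before-minus closing-row oc<n minus-at)))
    in j , j<oc , one

  closing-right-sum : sumIn (suc oc) n (ent X cr) ≡ 1ℤ
  closing-right-sum = IsLine-after-minus closing-row oc<n minus-at

  cc : ℕ
  cc = closingCol X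

  closing : IsLeastIn (suc oc) n (λ j → ent X cr j == 1ℤ) cc
  closing =
    let (w , oc<w , w<n , Xcrw≡1) = sumIn-bits-nonzero (suc oc) n (ent X cr) (λ j oc<j _ → bit-off-col cr (ℕP.>⇒≢ oc<j))
                                      (1≢0 ∘ trans (sym closing-right-sum))
    in leastIn-isLeast oc<w w<n (==-complete Xcrw≡1)

  oc<cc : oc ℕ.< cc
  oc<cc = IsLeastIn.lower closing

  cc<n : cc ℕ.< n
  cc<n = IsLeastIn.upper closing

  closing-one : ent X cr cc ≡ 1ℤ
  closing-one = ==-sound (IsLeastIn.holds closing)

  opening-closing-zero : ∀ j → oc ℕ.< j → j ℕ.< cc → ent X cr j ≡ 0ℤ
  opening-closing-zero j oc<j j<cc = bit-≠1⇒0 (bit-off-col cr (ℕP.>⇒≢ oc<j)) (IsLeastIn.minimal closing j oc<j j<cc)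

  right-of-closing-zero : ∀ j → cc ℕ.< j → j ℕ.< n → ent X cr j ≡ 0ℤ
  right-of-closing-zero = sumIn-nonneg-zero (suc cc) n (ent X cr) entries≥0
    (bit-after-one (sumIn-nonneg (suc cc) n (ent X cr) entries≥0) (subst Bit split (inj₂ closing-right-sum)))
    where
    entries≥0 : ∀ j → cc ℕ.< j → j ℕ.< n → 0ℤ ≤ ent X cr j
    entries≥0 j cc<j _ = Bit⇒nonneg (bit-off-col cr (ℕP.>⇒≢ (ℕP.<-trans oc<cc cc<j)))
    split : sumIn (suc oc) n (ent X cr) ≡ 1ℤ + sumIn (suc cc) n (ent X cr)
    split = begin
      sumIn (suc oc) n (ent X cr)
        ≡⟨ sumIn-split (suc oc) cc n (ent X cr) oc<cc (ℕP.<⇒≤ cc<n) ⟩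
      sumIn (suc oc) cc (ent X cr) + sumIn cc n (ent X cr)
        ≡⟨ cong (_+ sumIn cc n (ent X cr)) (sumIn-zero (suc oc) cc (ent X cr) opening-closing-zero) ⟩
      0ℤ + sumIn cc n (ent X cr)
        ≡⟨ ℤP.+-identityˡ _ ⟩
      sumIn cc n (ent X cr)
        ≡⟨ sumIn-cons cc n (ent X cr) cc<n ⟩
      ent X cr cc + sumIn (suc cc) n (ent X cr)
        ≡⟨ cong (_+ sumIn (suc cc) n (ent X cr)) closing-one ⟩
      1ℤ + sumIn (suc cc) n (ent X cr)
        ∎
      where open ≡-Reasoning


-- The map δ

module _ (r0 r1 c0 c1 i j : ℕ) where

  inBlock-sound : T (inBlock r0 r1 c0 c1 i j) → r0 ℕ.≤ i × i ℕ.< r1 × c0 ℕ.≤ j × j ℕ.< c1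
  inBlock-sound t with Equivalence.to T-∧ t
  ... | a , t′ with Equivalence.to T-∧ t′
  ...   | b , t″ with Equivalence.to T-∧ t″
  ...     | c , d = ℕP.≤ᵇ⇒≤ r0 i a , ℕP.<ᵇ⇒< i r1 b , ℕP.≤ᵇ⇒≤ c0 j c , ℕP.<ᵇ⇒< j c1 d

  inBlock-inside : r0 ℕ.≤ i → i ℕ.< r1 → c0 ℕ.≤ j → j ℕ.< c1 → inBlock r0 r1 c0 c1 i j ≡ true
  inBlock-inside a b c d =
    T⇒≡true (Equivalence.from T-∧ (ℕP.≤⇒≤ᵇ a , Equivalence.from T-∧ (ℕP.<⇒<ᵇ b , Equivalence.from T-∧ (ℕP.≤⇒≤ᵇ c , ℕP.<⇒<ᵇ d))))

  inBlock-above : i ℕ.< r0 → inBlock r0 r1 c0 c1 i j ≡ false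
  inBlock-above i<r0 = ¬T⇒≡false λ t → ℕP.<⇒≱ i<r0 (proj₁ (inBlock-sound t))

  inBlock-left : j ℕ.< c0 → inBlock r0 r1 c0 c1 i j ≡ false
  inBlock-left j<c0 = ¬T⇒≡false λ t → ℕP.<⇒≱ j<c0 (proj₁ (proj₂ (proj₂ (inBlock-sound t))))

  inBlock-right : c1 ℕ.≤ j → inBlock r0 r1 c0 c1 i j ≡ false
  inBlock-right c1≤j = ¬T⇒≡false λ t → ℕP.≤⇒≯ c1≤j (proj₂ (proj₂ (proj₂ (inBlock-sound t))))

module _ (r0 r1 c0 c1 : ℕ) (M : ℕ → ℕ → ℤ) where

  applyH-outside : ∀ {i j} → inBlock r0 r1 c0 c1 i j ≡ false → applyH r0 r1 c0 c1 M i j ≡ M i j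
  applyH-outside = if-false

  applyV-outside : ∀ {i j} → inBlock r0 r1 c0 c1 i j ≡ false → applyV r0 r1 c0 c1 M i j ≡ M i j
  applyV-outside = if-false

  applyV-top : ∀ {j m} → inBlock r0 r1 c0 c1 r0 j ≡ true →
    firstIn (suc r0) r1 (λ i′ → anyIn c0 c1 (λ j′ → not (M i′ j′ == 0ℤ))) ≡ just m →
    applyV r0 r1 c0 c1 M r0 j ≡ M m j
  applyV-top {j} inside first rewrite inside | T⇒≡true (ℕP.≡⇒≡ᵇ r0 r0 refl) | first = refl

  applyV-bit : ∀ {i j} → (∀ i′ → Bit (M i′ j)) → Bit (applyV r0 r1 c0 c1 M i j)
  applyV-bit {i} {j} bits with inBlock r0 r1 c0 c1 i j
  ... | false = bits i
  ... | true with (i ≡ᵇ r0) ∨ anyIn c0 c1 (λ j′ → not (M i j′ == 0ℤ))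
  ...   | false = inj₁ refl
  ...   | true with firstIn (suc i) r1 (λ i′ → anyIn c0 c1 (λ j′ → not (M i′ j′ == 0ℤ)))
  ...     | just m  = bits m
  ...     | nothing = inj₁ refl

-- The steps of δ, copied from Defs where they are private, so that δ X unfolds to step4.
module DeltaSteps {n : ℕ} (X : Matrix n) where

  private
    oc orr cr cc : ℕ
    oc  = openingCol X
    orr = openingRow X
    cr  = closingRow X
    cc  = closingCol X

  step1 : ℕ → ℕ → ℤ
  step1 i j = if (i ≡ᵇ cr) ∧ ((j ≡ᵇ oc) ∨ (j ≡ᵇ cc)) then 0ℤ else ent X i j

  step2 : ℕ → ℕ → ℤ
  step2 = applyH (suc cr) n oc (suc cc) step1

  step3 : ℕ → ℕ → ℤ
  step3 = applyV orr (suc cr) 0 oc step2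

  region : ℕ → ℕ → Bool
  region i j = inBlock orr (suc cr) 0 oc i j ∨ inBlock (suc orr) cr (suc oc) n i j

  step4 : ℕ → ℕ → ℤ
  step4 zero j = if region zero j ∧ (step3 zero j == 1ℤ) then 0ℤ else step3 zero j
  step4 (suc i) j =
    if region i j ∧ (step3 i j == 1ℤ) then 1ℤ
    else if region (suc i) j ∧ (step3 (suc i) j == 1ℤ) then 0ℤ
    else step3 (suc i) j

  δ≡step4 : ∀ a b → δ X a b ≡ step4 (toℕ a) (toℕ b)
  δ≡step4 a b with toℕ a
  ... | zero  = refl
  ... | suc _ = refl

  ent-δ : ∀ {i j} → i ℕ.< n → j ℕ.< n → ent (δ X) i j ≡ step4 i j
  ent-δ i<n j<n = trans (ent-inside (δ X) i<n j<n)
    (trans (δ≡step4 (fromℕ< i<n) (fromℕ< j<n)) (cong₂ step4 (FinP.toℕ-fromℕ< i<n) (FinP.toℕ-fromℕ< j<n)))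

  step4-unmoved : ∀ i j → (∀ i′ → i ≡ suc i′ → region i′ j ≡ false) →
    step4 i j ≡ (if region i j ∧ (step3 i j == 1ℤ) then 0ℤ else step3 i j)
  step4-unmoved zero    j _          = refl
  step4-unmoved (suc i) j prev-outside = if-false (cong (_∧ (step3 i j == 1ℤ)) (prev-outside i refl))

  step4-moved : ∀ i j → region i j ≡ true → region (suc i) j ≡ true →
    step4 (suc i) j ≡ (if step3 i j == 1ℤ then 1ℤ else if step3 (suc i) j == 1ℤ then 0ℤ else step3 (suc i) j)
  step4-moved i j in-i in-next =
    cong₂ (λ a b → if a ∧ (step3 i j == 1ℤ) then 1ℤ else if b ∧ (step3 (suc i) j == 1ℤ) then 0ℤ else step3 (suc i) j) in-i in-next

module DeltaProperties {n : ℕ} {X : Matrix n} (G : ASM₁ X) where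
  open Geometry G
  open DeltaSteps X

  step1-left : ∀ {i j} → j ℕ.< oc → step1 i j ≡ ent X i j
  step1-left {i} {j} j<oc = if-false (trans (cong ((i ≡ᵇ cr) ∧_) not-oc-nor-cc) (∧-zeroʳ (i ≡ᵇ cr)))
    where
    not-oc-nor-cc : ((j ≡ᵇ oc) ∨ (j ≡ᵇ cc)) ≡ false
    not-oc-nor-cc = cong₂ _∨_ (≢⇒≡ᵇfalse (ℕP.<⇒≢ j<oc)) (≢⇒≡ᵇfalse (ℕP.<⇒≢ (ℕP.<-trans j<oc oc<cc)))

  step1-off-closing-row : ∀ {i j} → ¬ i ≡ cr → step1 i j ≡ ent X i j
  step1-off-closing-row {i} {j} i≢cr = if-false (cong (_∧ ((j ≡ᵇ oc) ∨ (j ≡ᵇ cc))) (≢⇒≡ᵇfalse i≢cr))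

  step2-left : ∀ {i j} → j ℕ.< oc → step2 i j ≡ ent X i j
  step2-left {i} {j} j<oc =
    trans (applyH-outside (suc cr) n oc (suc cc) step1 {i} {j} (inBlock-left (suc cr) n oc (suc cc) i j j<oc)) (step1-left j<oc)

  step2-upper : ∀ {i j} → i ℕ.≤ cr → step2 i j ≡ step1 i j
  step2-upper {i} {j} i≤cr =
    applyH-outside (suc cr) n oc (suc cc) step1 {i} {j} (inBlock-above (suc cr) n oc (suc cc) i j (s≤s i≤cr))

  step3-above : ∀ {i j} → i ℕ.< k → step3 i j ≡ step2 i j
  step3-above {i} {j} i<k = applyV-outside k (suc cr) 0 oc step2 {i} {j} (inBlock-above k (suc cr) 0 oc i j i<k)

  step3-right : ∀ {i j} → oc ℕ.≤ j → step3 i j ≡ step2 i j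
  step3-right {i} {j} oc≤j = applyV-outside k (suc cr) 0 oc step2 {i} {j} (inBlock-right k (suc cr) 0 oc i j oc≤j)

  step3-left-bit : ∀ {i j} → j ℕ.< oc → Bit (step3 i j)
  step3-left-bit {i} {j} j<oc =
    applyV-bit k (suc cr) 0 oc step2 {i} {j} λ i′ → subst Bit (sym (step2-left j<oc)) (bit-off-col i′ (ℕP.<⇒≢ j<oc))

  region-above : ∀ {i j} → i ℕ.< k → region i j ≡ false
  region-above {i} {j} i<k = cong₂ _∨_ (inBlock-above k (suc cr) 0 oc i j i<k)
                                       (inBlock-above (suc k) cr (suc oc) n i j (ℕP.m<n⇒m<1+n i<k))

  region-left : ∀ {i j} → k ℕ.≤ i → i ℕ.≤ cr → j ℕ.< oc → region i j ≡ true
  region-left {i} {j} k≤i i≤cr j<oc =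
    cong (_∨ inBlock (suc k) cr (suc oc) n i j) (inBlock-inside k (suc cr) 0 oc i j k≤i (s≤s i≤cr) z≤n j<oc)

  region-opening : region k oc ≡ false
  region-opening = cong₂ _∨_ (inBlock-right k (suc cr) 0 oc k oc ℕP.≤-refl)
                             (inBlock-above (suc k) cr (suc oc) n k oc (ℕP.n<1+n k))

  unmoved : ∀ {i} j → i ℕ.≤ k → step4 i j ≡ (if region i j ∧ (step3 i j == 1ℤ) then 0ℤ else step3 i j)
  unmoved j i≤k = step4-unmoved _ j λ { i′ refl → region-above i≤k }

  δ-above : ∀ {i j} → i ℕ.< k → j ℕ.< n → ent (δ X) i j ≡ ent X i j
  δ-above {i} {j} i<k j<n = begin
    ent (δ X) i j                                            ≡⟨ ent-δ (ℕP.<-trans i<k k<n) j<n ⟩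
    step4 i j                                                ≡⟨ unmoved j (ℕP.<⇒≤ i<k) ⟩
    (if region i j ∧ (step3 i j == 1ℤ) then 0ℤ else step3 i j) ≡⟨ if-false (cong (_∧ (step3 i j == 1ℤ)) (region-above i<k)) ⟩
    step3 i j                                                ≡⟨ step3-above i<k ⟩
    step2 i j                                                ≡⟨ step2-upper (ℕP.<⇒≤ i<cr) ⟩
    step1 i j                                                ≡⟨ step1-off-closing-row (ℕP.<⇒≢ i<cr) ⟩
    ent X i j                                                ∎
    where
    open ≡-Reasoning
    i<cr : i ℕ.< cr
    i<cr = ℕP.<-trans i<k k<cr

  δ-opening-left : ∀ {j} → j ℕ.< oc → ent (δ X) k j ≡ 0ℤ
  δ-opening-left {j} j<oc = begin
    ent (δ X) k j                                            ≡⟨ ent-δ k<n (ℕP.<-trans j<oc oc<n) ⟩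
    step4 k j                                                ≡⟨ unmoved j ℕP.≤-refl ⟩
    (if region k j ∧ (step3 k j == 1ℤ) then 0ℤ else step3 k j) ≡⟨ cong (λ b → if b ∧ (step3 k j == 1ℤ) then 0ℤ else step3 k j)
                                                                   (region-left ℕP.≤-refl (ℕP.<⇒≤ k<cr) j<oc) ⟩
    (if step3 k j == 1ℤ then 0ℤ else step3 k j)              ≡⟨ bit-kill (step3-left-bit j<oc) ⟩
    0ℤ                                                       ∎
    where open ≡-Reasoning

  δ-opening-one : ent (δ X) k oc ≡ 1ℤ
  δ-opening-one = begin
    ent (δ X) k oc                                             ≡⟨ ent-δ k<n oc<n ⟩
    step4 k oc                                                 ≡⟨ unmoved oc ℕP.≤-refl ⟩
    (if region k oc ∧ (step3 k oc == 1ℤ) then 0ℤ else step3 k oc) ≡⟨ if-false (cong (_∧ (step3 k oc == 1ℤ)) region-opening) ⟩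
    step3 k oc                                                 ≡⟨ step3-right ℕP.≤-refl ⟩
    step2 k oc                                                 ≡⟨ step2-upper (ℕP.<⇒≤ k<cr) ⟩
    step1 k oc                                                 ≡⟨ step1-off-closing-row (ℕP.<⇒≢ k<cr) ⟩
    ent X k oc                                                 ≡⟨ opening-one ⟩
    1ℤ                                                         ∎
    where open ≡-Reasoning

  openingCol-δ : oc ≡ leastIn 0 n (λ j → ent (δ X) k j == 1ℤ)
  openingCol-δ = sym (leastIn-least record
    { lower   = z≤n
    ; upper   = oc<n
    ; holds   = ==-complete δ-opening-one
    ; minimal = λ j _ j<oc → cong (_== 1ℤ) (δ-opening-left j<oc)
    })

  private
    hasLeftOne : ℕ → Bool
    hasLeftOne i = anyIn 0 oc (λ j → ent X i j == 1ℤ)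

  closing-has-left-one : hasLeftOne cr ≡ true
  closing-has-left-one =
    let (j , j<oc , Xcrj≡1) = closing-left-one
    in anyIn-true 0 oc (λ j → ent X cr j == 1ℤ) z≤n j<oc (==-complete Xcrj≡1)

  leading : IsLeastIn (suc k) n hasLeftOne (leadingRow X)
  leading = leastIn-isLeast k<cr cr<n closing-has-left-one

  leadingRow≤cr : leadingRow X ℕ.≤ cr
  leadingRow≤cr = least≤witness leading k<cr closing-has-left-one

  firstIn-nonzero-row : firstIn (suc k) (suc cr) (λ i → anyIn 0 oc (λ j → not (step2 i j == 0ℤ))) ≡ just (leadingRow X)
  firstIn-nonzero-row = trans (firstIn-cong (suc k) (suc cr) nonzero≗leftOne) (firstIn-least record
    { lower   = IsLeastIn.lower leading
    ; upper   = s≤s leadingRow≤cr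
    ; holds   = IsLeastIn.holds leading
    ; minimal = IsLeastIn.minimal leading
    })
    where
    nonzero≗leftOne : ∀ i → suc k ℕ.≤ i → i ℕ.< suc cr → anyIn 0 oc (λ j → not (step2 i j == 0ℤ)) ≡ hasLeftOne i
    nonzero≗leftOne i _ _ = anyIn-cong 0 oc λ j _ j<oc →
      trans (cong (λ x → not (x == 0ℤ)) (step2-left j<oc)) (bit-nonzero (bit-off-col i (ℕP.<⇒≢ j<oc)))

  step3-opening-row : ∀ {j} → j ℕ.< oc → step3 k j ≡ ent X (leadingRow X) j
  step3-opening-row {j} j<oc =
    trans (applyV-top k (suc cr) 0 oc step2 (inBlock-inside k (suc cr) 0 oc k j ℕP.≤-refl (s≤s (ℕP.<⇒≤ k<cr)) z≤n j<oc) firstIn-nonzero-row)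
          (step2-left j<oc)

  δ-below-opening : ∀ {j} → j ℕ.< oc → (ent (δ X) (suc k) j == 1ℤ) ≡ (ent X (leadingRow X) j == 1ℤ)
  δ-below-opening {j} j<oc = begin
    (ent (δ X) (suc k) j == 1ℤ)                           ≡⟨ cong (_== 1ℤ) (ent-δ (ℕP.≤-<-trans k<cr cr<n) (ℕP.<-trans j<oc oc<n)) ⟩
    (step4 (suc k) j == 1ℤ)                               ≡⟨ cong (_== 1ℤ) (step4-moved k j (region-left ℕP.≤-refl (ℕP.<⇒≤ k<cr) j<oc)
                                                                                          (region-left (ℕP.n≤1+n k) k<cr j<oc)) ⟩
    ((if s3k then 1ℤ else if s3k′ then 0ℤ else step3 (suc k) j) == 1ℤ)
                                                          ≡⟨ cong (λ x → (if s3k then 1ℤ else x) == 1ℤ) (bit-kill (step3-left-bit j<oc)) ⟩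
    ((if s3k then 1ℤ else 0ℤ) == 1ℤ)                      ≡⟨ bit-indicator (step3-left-bit j<oc) ⟩
    (step3 k j == 1ℤ)                                     ≡⟨ cong (_== 1ℤ) (step3-opening-row j<oc) ⟩
    (ent X (leadingRow X) j == 1ℤ)                        ∎
    where
    open ≡-Reasoning
    s3k s3k′ : Bool
    s3k  = step3 k j == 1ℤ
    s3k′ = step3 (suc k) j == 1ℤ

  leadingCol-δ : leadingCol X ≡ leastIn 0 oc (λ j → ent (δ X) (suc k) j == 1ℤ)
  leadingCol-δ = leastIn-cong 0 oc λ j _ j<oc → sym (δ-below-opening j<oc)

  column-split : ∀ {j} → j ℕ.< oc → sumIn 0 k (λ i → ent (δ X) i j) + sumIn (suc k) n (λ i → ent X i j) ≡ 1ℤ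
  column-split {j} j<oc = begin
    sumIn 0 k (λ i → ent (δ X) i j) + below                  ≡⟨ cong (_+ below) (sumIn-cong 0 k λ i _ i<k → δ-above i<k j<n) ⟩
    sumIn 0 k column + below                                 ≡⟨ cong (_+ below) (ℤP.+-identityʳ (sumIn 0 k column)) ⟨
    sumIn 0 k column + 0ℤ + below                            ≡⟨ cong (λ x → sumIn 0 k column + x + below) (opening-row-left j j<oc) ⟨
    sumIn 0 k column + column k + below                      ≡⟨ cong (_+ below) (sumIn-snoc 0 k column z≤n) ⟨
    sumIn 0 (suc k) column + below                           ≡⟨ sumIn-split 0 (suc k) n column z≤n k<n ⟨
    sumIn 0 n column                                         ≡⟨ IsLine.total (ASM₁.col G j j<n) ⟩
    1ℤ                                                       ∎
    where
    open ≡-Reasoning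
    j<n : j ℕ.< n
    j<n = ℕP.<-trans j<oc oc<n
    column : ℕ → ℤ
    column i = ent X i j
    below : ℤ
    below = sumIn (suc k) n column


-- δ and the opening row determine ℓ

module _ {n : ℕ} {A N : Matrix n} (GA : ASM₁ A) (GN : ASM₁ N)
         (same-openingRow : openingRow N ≡ openingRow A)
         (same-δ : ∀ a b → δ N a b ≡ δ A a b) where

  private
    module FA = DeltaProperties GA
    module FN = DeltaProperties GN

    k oc : ℕ
    k  = openingRow A
    oc = openingCol A

    δN≗δA : ∀ i j → ent (δ N) i j ≡ ent (δ A) i j
    δN≗δA = ent-cong same-δ

    openingCol-invariant : openingCol N ≡ oc
    openingCol-invariant = begin
      openingCol N                                     ≡⟨ FN.openingCol-δ ⟩
      leastIn 0 n (λ j → ent (δ N) (openingRow N) j == 1ℤ) ≡⟨ cong (λ r → leastIn 0 n (λ j → ent (δ N) r j == 1ℤ)) same-openingRow ⟩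
      leastIn 0 n (λ j → ent (δ N) k j == 1ℤ)          ≡⟨ leastIn-cong 0 n (λ j _ _ → cong (_== 1ℤ) (δN≗δA k j)) ⟩
      leastIn 0 n (λ j → ent (δ A) k j == 1ℤ)          ≡⟨ FA.openingCol-δ ⟨
      oc                                               ∎
      where open ≡-Reasoning

    leadingCol-invariant : leadingCol N ≡ leadingCol A
    leadingCol-invariant = begin
      leadingCol N                                                   ≡⟨ FN.leadingCol-δ ⟩
      leastIn 0 (openingCol N) (λ j → ent (δ N) (suc (openingRow N)) j == 1ℤ)
                                   ≡⟨ cong₂ (λ c r → leastIn 0 c (λ j → ent (δ N) (suc r) j == 1ℤ)) openingCol-invariant same-openingRow ⟩
      leastIn 0 oc (λ j → ent (δ N) (suc k) j == 1ℤ)                 ≡⟨ leastIn-cong 0 oc (λ j _ _ → cong (_== 1ℤ) (δN≗δA (suc k) j)) ⟩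
      leastIn 0 oc (λ j → ent (δ A) (suc k) j == 1ℤ)                 ≡⟨ FA.leadingCol-δ ⟨
      leadingCol A                                                   ∎
      where open ≡-Reasoning

    column-below-invariant : ∀ j → j ℕ.< oc → sumIn (suc k) n (λ i → ent N i j) ≡ sumIn (suc k) n (λ i → ent A i j)
    column-below-invariant j j<oc = ∙-cancelˡ (sumIn 0 k (λ i → ent (δ A) i j)) _ _ (trans splitN (sym (FA.column-split j<oc)))
      where
      splitN : sumIn 0 k (λ i → ent (δ A) i j) + sumIn (suc k) n (λ i → ent N i j) ≡ 1ℤ
      splitN = begin
        sumIn 0 k (λ i → ent (δ A) i j) + sumIn (suc k) n (λ i → ent N i j)
          ≡⟨ cong (_+ sumIn (suc k) n (λ i → ent N i j)) (sumIn-cong 0 k (λ i _ _ → δN≗δA i j)) ⟨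
        sumIn 0 k (λ i → ent (δ N) i j) + sumIn (suc k) n (λ i → ent N i j)
          ≡⟨ subst (λ r → sumIn 0 r (λ i → ent (δ N) i j) + sumIn (suc r) n (λ i → ent N i j) ≡ 1ℤ) same-openingRow
                   (FN.column-split (subst (j ℕ.<_) (sym openingCol-invariant) j<oc)) ⟩
        1ℤ ∎
        where open ≡-Reasoning

  ℓ-invariant : ℓ N ≡ ℓ A
  ℓ-invariant = begin
    ℓ N
      ≡⟨ cong₂ (λ r l → blockSum N (suc r) n (suc l) (openingCol N)) same-openingRow leadingCol-invariant ⟩
    blockSum N (suc k) n (suc lc) (openingCol N)
      ≡⟨ cong (blockSum N (suc k) n (suc lc)) openingCol-invariant ⟩
    blockSum N (suc k) n (suc lc) oc
      ≡⟨ sumIn-swap (suc k) n (suc lc) oc (ent N) ⟩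
    sumIn (suc lc) oc (λ j → sumIn (suc k) n (λ i → ent N i j))
      ≡⟨ sumIn-cong (suc lc) oc (λ j _ j<oc → column-below-invariant j j<oc) ⟩
    sumIn (suc lc) oc (λ j → sumIn (suc k) n (λ i → ent A i j))
      ≡⟨ sumIn-swap (suc k) n (suc lc) oc (ent A) ⟨
    ℓ A
      ∎
    where
    open ≡-Reasoning
    lc : ℕ
    lc = leadingCol A


-- sign A is definitionally classify (NoEnclosedRows A) (LowestEnclosedRight A).
private
  classify : Bool → Bool → Sign
  classify noEnclosed lowestRight = if noEnclosed then neutral else if lowestRight then positive else negative

  classify-neutral : ∀ a b → classify a b ≡ neutral → a ≡ true
  classify-neutral true  _     _  = refl
  classify-neutral false true  ()
  classify-neutral false false ()

  classify-negative : ∀ a b → classify a b ≡ negative → a ≡ false × b ≡ false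
  classify-negative true  _     ()
  classify-negative false true  ()
  classify-negative false false _  = refl , refl

module _ {n : ℕ} (A : Matrix n) where

  NoEnclosedRows : Bool
  NoEnclosedRows = closingRow A ≤ᵇ suc (openingRow A)

  LowestEnclosedRight : Bool
  LowestEnclosedRight = anyIn (suc (openingCol A)) n (λ j → ent A (closingRow A ∸ 1) j == 1ℤ)

  neutral⇒no-enclosed : sign A ≡ neutral → closingRow A ℕ.≤ suc (openingRow A)
  neutral⇒no-enclosed neu = ℕP.≤ᵇ⇒≤ _ _ (subst T (sym (classify-neutral NoEnclosedRows LowestEnclosedRight neu)) tt)

  no-enclosed⇒neutral : closingRow A ℕ.≤ suc (openingRow A) → sign A ≡ neutral
  no-enclosed⇒neutral cr≤ = cong (λ a → classify a LowestEnclosedRight) (T⇒≡true (ℕP.≤⇒≤ᵇ cr≤))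

  negative⇒enclosed-left : sign A ≡ negative → suc (openingRow A) ℕ.< closingRow A × LowestEnclosedRight ≡ false
  negative⇒enclosed-left negA =
    let (enclosed , left) = classify-negative NoEnclosedRows LowestEnclosedRight negA
    in ℕP.≰⇒> (λ cr≤ → true≢false (trans (sym (T⇒≡true (ℕP.≤⇒≤ᵇ cr≤))) enclosed)) , left

  enclosed-right⇒positive : suc (openingRow A) ℕ.< closingRow A → LowestEnclosedRight ≡ true → sign A ≡ positive
  enclosed-right⇒positive k+1<cr right =
    cong₂ classify (¬T⇒≡false (λ t → ℕP.<⇒≱ k+1<cr (ℕP.≤ᵇ⇒≤ (closingRow A) (suc (openingRow A)) t))) right

  -- Going through B-by-sign spares the with-abstraction a normalisation of B₀ A.
  private
    B-by-sign : Sign → ℤ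
    B-by-sign positive = B₀ A
    B-by-sign neutral  = B₀ A
    B-by-sign negative = - B₀ (reflect A)

    B≡B-by-sign : B A ≡ B-by-sign (sign A)
    B≡B-by-sign with sign A
    ... | positive = refl
    ... | neutral  = refl
    ... | negative = refl

    B-by-nonnegative : ∀ s → ¬ s ≡ negative → B-by-sign s ≡ B₀ A
    B-by-nonnegative positive _    = refl
    B-by-nonnegative neutral  _    = refl
    B-by-nonnegative negative ¬neg = ⊥-elim (¬neg refl)

  B-nonnegative : ¬ sign A ≡ negative → B A ≡ B₀ A
  B-nonnegative ¬neg = trans B≡B-by-sign (B-by-nonnegative (sign A) ¬neg)

  B-negative : sign A ≡ negative → B A ≡ - B₀ (reflect A)
  B-negative negA = trans B≡B-by-sign (cong B-by-sign negA)

  E₀-nonneg : 0ℤ ≤ chargedSum A → 0ℤ ≤ E₀ A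
  E₀-nonneg charged≥0 with sign A
  ... | positive = charged≥0
  ... | neutral  = ℤP.≤-refl
  ... | negative = ℤP.≤-refl

  E-nonneg : ¬ sign A ≡ negative → 0ℤ ≤ chargedSum A → 0ℤ ≤ E A
  E-nonneg ¬neg charged≥0 with sign A
  ... | positive = E₀-nonneg charged≥0
  ... | neutral  = E₀-nonneg charged≥0
  ... | negative = ⊥-elim (¬neg refl)


-- Reflection

module Mirrored {n : ℕ} {X Y : Matrix n} (GX : ASM₁ X) (X⇄Y : Mirror X Y) where

  private
    GY : ASM₁ Y
    GY = ASM₁-mirror GX X⇄Y

    module GeoX = Geometry GX
    module GeoY = Geometry GY
    open GeoX using (k; oc; cr; cc)

  closingRow-mirror : closingRow Y ≡ cr
  closingRow-mirror = trans GeoY.closingRow≡minusRow (sym GeoX.closingRow≡minusRow)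

  openingCol-mirror : openingCol Y ≡ n ∸ suc oc
  openingCol-mirror = trans GeoY.openingCol≡minusCol (cong (λ c → n ∸ suc c) (sym GeoX.openingCol≡minusCol))

  openingRow-mirror : openingRow Y ≡ k
  openingRow-mirror = begin
    openingRow Y                                     ≡⟨ cong (λ c → leastIn 0 n (λ i → ent Y i c == 1ℤ)) openingCol-mirror ⟩
    leastIn 0 n (λ i → ent Y i (n ∸ suc oc) == 1ℤ)   ≡⟨ leastIn-cong 0 n (λ i _ _ → cong (_== 1ℤ) (trans (X⇄Y i _ (opposite< GeoX.oc<n))
                                                                                              (cong (ent X i) (opposite-involutive GeoX.oc<n)))) ⟩
    k                                                ∎
    where open ≡-Reasoning

  neutral-mirror : sign X ≡ neutral → sign Y ≡ neutral
  neutral-mirror neu = no-enclosed⇒neutral Y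
    (subst₂ (λ r k′ → r ℕ.≤ suc k′) (sym closingRow-mirror) (sym openingRow-mirror) (neutral⇒no-enclosed X neu))

  ℓ-mirror-neutral : sign X ≡ neutral → ℓ Y ≡ c X
  ℓ-mirror-neutral neu = begin
    ℓ Y
      ≡⟨ cong₂ (λ r l → blockSum Y (suc r) n (suc l) (openingCol Y)) openingRow-mirror leadingCol-mirror ⟩
    blockSum Y (suc k) n (suc (n ∸ suc cc)) (openingCol Y)
      ≡⟨ cong₂ (λ r c′ → blockSum Y r n (suc (n ∸ suc cc)) c′) (sym cr≡1+k) openingCol-mirror ⟩
    blockSum Y cr n (suc (n ∸ suc cc)) (n ∸ suc oc)
      ≡⟨ cong (λ l → blockSum Y cr n l (n ∸ suc oc)) (ℕP.+-∸-assoc 1 GeoX.cc<n) ⟨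
    sumIn cr n (λ i → sumIn (n ∸ cc) (n ∸ suc oc) (ent Y i))
      ≡⟨ sumIn-cong cr n (λ i _ _ → unmirror i) ⟩
    sumIn cr n (λ i → sumIn (suc oc) cc (ent X i))
      ≡⟨ sumIn-cons cr n (λ i → sumIn (suc oc) cc (ent X i)) GeoX.cr<n ⟩
    sumIn (suc oc) cc (ent X cr) + c X
      ≡⟨ cong (_+ c X) (sumIn-zero (suc oc) cc (ent X cr) GeoX.opening-closing-zero) ⟩
    0ℤ + c X
      ≡⟨ ℤP.+-identityˡ (c X) ⟩
    c X
      ∎
    where
    open ≡-Reasoning
    cr≡1+k : cr ≡ suc k
    cr≡1+k = ℕP.≤-antisym (neutral⇒no-enclosed X neu) GeoX.k<cr

    leadingRow-mirror : leadingRow Y ≡ cr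
    leadingRow-mirror =
      ℕP.≤-antisym (subst (leadingRow Y ℕ.≤_) closingRow-mirror (DeltaProperties.leadingRow≤cr GY))
                   (subst (ℕ._≤ leadingRow Y) (trans (cong suc openingRow-mirror) (sym cr≡1+k))
                          (IsLeastIn.lower (DeltaProperties.leading GY)))

    leadingCol-mirror : leadingCol Y ≡ n ∸ suc cc
    leadingCol-mirror = trans (cong₂ (λ c′ r → leastIn 0 c′ (λ j → ent Y r j == 1ℤ)) openingCol-mirror leadingRow-mirror)
      (leastIn-least record
        { lower   = z≤n
        ; upper   = ℕP.∸-monoʳ-< (s≤s GeoX.oc<cc) GeoX.cc<n
        ; holds   = ==-complete (trans (X⇄Y cr _ (opposite< GeoX.cc<n))
                                       (trans (cong (ent X cr) (opposite-involutive GeoX.cc<n)) GeoX.closing-one))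
        ; minimal = λ j _ j< → let j<n = ℕP.<-≤-trans j< (ℕP.m∸n≤m n (suc cc)) in
            cong (_== 1ℤ) (trans (X⇄Y cr j j<n) (GeoX.right-of-closing-zero (n ∸ suc j) (opposite-swap {n} {j} {cc} j<) (opposite< j<n)))
        })

    unmirror : ∀ i → sumIn (n ∸ cc) (n ∸ suc oc) (ent Y i) ≡ sumIn (suc oc) cc (ent X i)
    unmirror i = begin
      sumIn (n ∸ cc) (n ∸ suc oc) (ent Y i)
        ≡⟨ sumIn-cong (n ∸ cc) (n ∸ suc oc) (λ j _ j< → X⇄Y i j (ℕP.<-≤-trans j< (ℕP.m∸n≤m n (suc oc)))) ⟩
      sumIn (n ∸ cc) (n ∸ suc oc) (λ j → ent X i (n ∸ suc j))
        ≡⟨ sumIn-mirror n (ent X i) (ℕP.∸-monoʳ-≤ n GeoX.oc<cc) (ℕP.m∸n≤m n (suc oc)) ⟩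
      sumIn (n ∸ (n ∸ suc oc)) (n ∸ (n ∸ cc)) (ent X i)
        ≡⟨ cong₂ (λ a b → sumIn a b (ent X i)) (ℕP.m∸[m∸n]≡n GeoX.oc<n) (ℕP.m∸[m∸n]≡n (ℕP.<⇒≤ GeoX.cc<n)) ⟩
      sumIn (suc oc) cc (ent X i)
        ∎

  module _ (negX : sign X ≡ negative) where

    private
      enclosed : suc k ℕ.< cr
      enclosed = proj₁ (negative⇒enclosed-left X negX)

      lowest : ℕ
      lowest = cr ∸ 1

      k<lowest : k ℕ.< lowest
      k<lowest = ℕP.∸-monoˡ-≤ 1 enclosed

      lowest<cr : lowest ℕ.< cr
      lowest<cr = ℕP.∸-monoʳ-< {o = 0} (s≤s z≤n) (ℕP.<-trans (s≤s z≤n) enclosed)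

      lowest-right-zero : ∀ j → suc oc ℕ.≤ j → j ℕ.< n → ent X lowest j ≡ 0ℤ
      lowest-right-zero j oc<j j<n =
        bit-≠1⇒0 (GeoX.bit-off-row j (ℕP.<⇒≢ lowest<cr))
               (anyIn-false (suc oc) n (λ j → ent X lowest j == 1ℤ) (proj₂ (negative⇒enclosed-left X negX)) oc<j j<n)

      lowest-left-sum : sumIn 0 oc (ent X lowest) ≡ 1ℤ
      lowest-left-sum = begin
        sumIn 0 oc (ent X lowest)                               ≡⟨ ℤP.+-identityʳ _ ⟨
        sumIn 0 oc (ent X lowest) + 0ℤ                          ≡⟨ cong (_+_ (sumIn 0 oc (ent X lowest))) from-oc≡0 ⟨
        sumIn 0 oc (ent X lowest) + sumIn oc n (ent X lowest)   ≡⟨ sumIn-split 0 oc n (ent X lowest) z≤n (ℕP.<⇒≤ GeoX.oc<n) ⟨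
        sumIn 0 n (ent X lowest)                                ≡⟨ IsLine.total (ASM₁.row GX lowest (ℕP.<-trans lowest<cr GeoX.cr<n)) ⟩
        1ℤ                                                      ∎
        where
        open ≡-Reasoning
        from-oc≡0 : sumIn oc n (ent X lowest) ≡ 0ℤ
        from-oc≡0 = trans (sumIn-cons oc n (ent X lowest) GeoX.oc<n)
                          (cong₂ _+_ (GeoX.enclosed-zero lowest k<lowest lowest<cr) (sumIn-zero (suc oc) n (ent X lowest) lowest-right-zero))

      lowest-left-one : Σ ℕ λ j → j ℕ.< oc × ent X lowest j ≡ 1ℤ
      lowest-left-one =
        let (j , _ , j<oc , one) = sumIn-bits-nonzero 0 oc (ent X lowest) (λ j _ _ → GeoX.bit-off-row j (ℕP.<⇒≢ lowest<cr))
                                     (1≢0 ∘ trans (sym lowest-left-sum))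
        in j , j<oc , one

      mirrored-lowest-right : LowestEnclosedRight Y ≡ true
      mirrored-lowest-right =
        let (j , j<oc , one) = lowest-left-one
            j<n = ℕP.<-trans j<oc GeoX.oc<n
        in anyIn-true (suc (openingCol Y)) n (λ j′ → ent Y (closingRow Y ∸ 1) j′ == 1ℤ)
             (subst (λ c′ → suc c′ ℕ.≤ n ∸ suc j) (sym openingCol-mirror) (ℕP.∸-monoʳ-< (s≤s j<oc) GeoX.oc<n))
             (opposite< j<n)
             (==-complete (begin
               ent Y (closingRow Y ∸ 1) (n ∸ suc j)           ≡⟨ cong (λ r → ent Y (r ∸ 1) (n ∸ suc j)) closingRow-mirror ⟩
               ent Y lowest (n ∸ suc j)                       ≡⟨ X⇄Y lowest (n ∸ suc j) (opposite< j<n) ⟩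
               ent X lowest (n ∸ suc (n ∸ suc j))             ≡⟨ cong (ent X lowest) (opposite-involutive j<n) ⟩
               ent X lowest j                                 ≡⟨ one ⟩
               1ℤ                                             ∎))
        where open ≡-Reasoning

    negative-mirror : sign Y ≡ positive
    negative-mirror = enclosed-right⇒positive Y
      (subst₂ (λ k′ r → suc k′ ℕ.< r) (sym openingRow-mirror) (sym closingRow-mirror) enclosed)
      mirrored-lowest-right


cell-bounds : ∀ {c l e : ℤ} → 0ℤ ≤ c → 0ℤ ≤ l → 0ℤ ≤ e → (- l ≤ c - l) × (c - l ≤ c + e)
cell-bounds {c} {l} {e} c≥0 l≥0 e≥0 =
  subst (_≤ c - l) (ℤP.+-identityˡ (- l)) (ℤP.+-monoˡ-≤ (- l) c≥0) ,
  ℤP.+-monoʳ-≤ c (ℤP.≤-trans (ℤP.neg-mono-≤ l≥0) e≥0)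

negate-bounds : ∀ {l b c : ℤ} → (- l ≤ b) × (b ≤ c) → (- c ≤ - b) × (- b ≤ l)
negate-bounds {l} (-l≤b , b≤c) = ℤP.neg-mono-≤ b≤c , subst (_ ≤_) (ℤP.neg-involutive l) (ℤP.neg-mono-≤ -l≤b)

bounds-nonnegative : ∀ {n} {A N : Matrix n} {F} → ASM₁ A → Λrel A N F → ¬ sign A ≡ negative →
                     (- ℓ N ≤ B₀ A) × (B₀ A ≤ c N)
bounds-nonnegative {n} {A} {N} GA (nonneg _ inN _ same-row same-δ cN≡cA+EA _) ¬neg =
  subst₂ (λ l c′ → (- l ≤ B₀ A) × (B₀ A ≤ c′))
         (sym (ℓ-invariant GA (InA1⇒ASM₁ inN) same-row same-δ)) (sym cN≡cA+EA)
         (cell-bounds c≥0 ℓ≥0 (E-nonneg A ¬neg charged≥0))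
  where
  open Geometry GA
  c≥0 : 0ℤ ≤ c A
  c≥0 = blockSum-nonneg (suc cr) n (suc oc) cc (λ j oc<j _ → ℕP.>⇒≢ oc<j)
  ℓ≥0 : 0ℤ ≤ ℓ A
  ℓ≥0 = blockSum-nonneg (suc k) n (suc (leadingCol A)) oc (λ j _ j<oc → ℕP.<⇒≢ j<oc)
  charged≥0 : 0ℤ ≤ chargedSum A
  charged≥0 = blockSum-nonneg (suc k) cr (suc oc) n (λ j oc<j _ → ℕP.>⇒≢ oc<j)
bounds-nonnegative GA (neg negA _) ¬neg = ⊥-elim (¬neg negA)

positive≢negative : ¬ positive ≡ negative
positive≢negative ()

bounds-negative : ∀ {n} {A M : Matrix n} {F} → ASM₁ A → sign A ≡ negative → Λrel (reflect A) M F →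
                  (- ℓ (reflect M) ≤ B A) × (B A ≤ c (reflect M))
bounds-negative {A = A} {M} GA negA Λ̄@(nonneg ¬negĀ inM neuM _ _ _ _) =
  subst₂ (λ l c′ → (- l ≤ B A) × (B A ≤ c′)) (sym ℓM̄≡cM) (sym cM̄≡ℓM)
    (subst (λ b → (- c M ≤ b) × (b ≤ ℓ M)) (sym (B-negative A negA))
      (negate-bounds (bounds-nonnegative (ASM₁-mirror GA (reflect-mirror A)) Λ̄ ¬negĀ)))
  where
  GM : ASM₁ M
  GM = InA1⇒ASM₁ inM
  ℓM̄≡cM : ℓ (reflect M) ≡ c M
  ℓM̄≡cM = Mirrored.ℓ-mirror-neutral GM (reflect-mirror M) neuM
  cM̄≡ℓM : c (reflect M) ≡ ℓ M
  cM̄≡ℓM = sym (Mirrored.ℓ-mirror-neutral (ASM₁-mirror GM (reflect-mirror M)) (mirror-sym (reflect-mirror M))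
                                          (Mirrored.neutral-mirror GM (reflect-mirror M) neuM))
bounds-negative {A = A} GA negA (neg negĀ _) =
  ⊥-elim (positive≢negative (trans (sym (Mirrored.negative-mirror GA (reflect-mirror A) negA)) negĀ))

mainTheorem4 : (n : ℕ) (A : Matrix n) → InA1 A →
    (N : Matrix n) (F : ℤ) → Λrel A N F →
    (- ℓ N ≤ B A) × (B A ≤ c N)
mainTheorem4 n A inA N _ Λ@(nonneg ¬neg _ _ _ _ _ _) =
  subst (λ b → (- ℓ N ≤ b) × (b ≤ c N)) (sym (B-nonnegative A ¬neg)) (bounds-nonnegative (InA1⇒ASM₁ inA) Λ ¬neg)
mainTheorem4 n A inA _ _ (neg negA Λ̄) = bounds-negative (InA1⇒ASM₁ inA) negA Λ̄
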